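{- $\Delta^0_2\text{ - }\mathsf{LEM}$ is Weihrauch reducible to $\mathsf{Unique}\,\Sigma^0_2\text{ - }\mathsf{LLPO}$.
   Context: A realizer of a partial multi-valued function $F:\subseteq\mathbb{N}^\mathbb{N}\rightrightarrows\mathbb{N}^\mathbb{N}$ is a single-valued $q$ with $q(x)\in F(x)$ for all $x\in\mathrm{dom}(F)$. $F\le_WG$ (Weihrauch reducibility) iff there are partial computable $H,K$ with $K(x,q(H(x)))\in F(x)$ for every $x\in\mathrm{dom}(F)$ and every realizer $q$ of $G$ (finite objects like $\mathbb{N}$, $2$, pairs are coded into Baire space). $\{\Phi_e\}$ enumerates partial computable functions on $\mathbb{N}^\mathbb{N}$; $\mathrm{Tot}_e=\{\alpha\in\mathbb{N}^\mathbb{N}:\Phi_e(\alpha;n)\downarrow$ for all $n\}$. $\Delta^0_2\text{ - }\mathsf{LEM}:\subseteq\mathbb{N}^2\times\mathbb{N}^\mathbb{N}\to2$ has domain $\{(i,j,p):\mathrm{Tot}_i=\mathbb{N}^\mathbb{N}\setminus\mathrm{Tot}_j\}$ and value $0$ if $p\in\mathrm{Tot}_i$, $1$ otherwise. $\Sigma^0_2\text{ - }\mathsf{LLPO}:\subseteq(\mathbb{N}^\mathbb{N})^2\rightrightarrows2$ has domain the pairs $(p_0,p_1)$ such that some $p_i$ takes value $0$ infinitely often, and $i\in\Sigma^0_2\text{ - }\mathsf{LLPO}(p_0,p_1)$ iff $p_i(n)=0$ for infinitely many $n$. For a multi-valued $F$, $\mathsf{Unique}F$ is the restriction of $F$ to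 $\{x\in\mathrm{dom}(F):\#F(x)=1\}$. -}

module Defs where

open import Data.Nat using (ℕ; zero; suc; _+_; _*_; _^_; _≤_; _<_)
open import Data.List using (List; []; _∷_)
open import Data.Product using (Σ; ∃; _×_; _,_)
open import Data.Sum using (_⊎_)
open import Relation.Nullary using (¬_)
open import Relation.Binary.PropositionalEquality using (_≡_)

Baire : Set
Baire = ℕ → ℕ

_≈B_ : Baire → Baire → Set
α ≈B β = ∀ n → α n ≡ β n

-- Oracle partial recursive functions (Kleene's Φ^α), untyped codes
-- acting on argument lists.

data Code : Set where
  Zc : Code
  Sc : Code
  Pc : ℕ → Code
  Oc : Code
  Cc : Code → List Code → Code
  Rc : Code → Code → Code
  Mc : Code → Code

data Nth : ℕ → List ℕ → ℕ → Set where
  here  : ∀ {x xs} → Nth zero (x ∷ xs) x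
  there : ∀ {i x y xs} → Nth i xs y → Nth (suc i) (x ∷ xs) y

mutual
  data Eval (α : Baire) : Code → List ℕ → ℕ → Set where
    ev-Z : ∀ {xs} → Eval α Zc xs zero
    ev-S : ∀ {x xs} → Eval α Sc (x ∷ xs) (suc x)
    ev-P : ∀ {i xs v} → Nth i xs v → Eval α (Pc i) xs v
    ev-O : ∀ {x xs} → Eval α Oc (x ∷ xs) (α x)
    ev-C : ∀ {f gs xs ys v} → EvalList α gs xs ys → Eval α f ys v →
           Eval α (Cc f gs) xs v
    ev-R0 : ∀ {f g xs v} → Eval α f xs v → Eval α (Rc f g) (zero ∷ xs) v
    ev-RS : ∀ {f g n xs w v} → Eval α (Rc f g) (n ∷ xs) w →
            Eval α g (n ∷ w ∷ xs) v → Eval α (Rc f g) (suc n ∷ xs) v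
    ev-M : ∀ {f xs y} → Eval α f (y ∷ xs) zero →
           (∀ z → z < y → Σ ℕ (λ w → Eval α f (z ∷ xs) (suc w))) →
           Eval α (Mc f) xs y

  data EvalList (α : Baire) : List Code → List ℕ → List ℕ → Set where
    evl-[] : ∀ {xs} → EvalList α [] xs []
    evl-∷  : ∀ {g gs xs y ys} → Eval α g xs y → EvalList α gs xs ys →
             EvalList α (g ∷ gs) xs (y ∷ ys)

⟪_,_⟫ : ℕ → ℕ → ℕ
⟪ a , b ⟫ = (2 ^ a) * (2 * b + 1)

mutual
  ⌜_⌝c : Code → ℕ
  ⌜ Zc ⌝c = ⟪ 0 , 0 ⟫
  ⌜ Sc ⌝c = ⟪ 1 , 0 ⟫
  ⌜ Pc i ⌝c = ⟪ 2 , i ⟫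
  ⌜ Oc ⌝c = ⟪ 3 , 0 ⟫
  ⌜ Cc f gs ⌝c = ⟪ 4 , ⟪ ⌜ f ⌝c , ⌜ gs ⌝cs ⟫ ⟫
  ⌜ Rc f g ⌝c = ⟪ 5 , ⟪ ⌜ f ⌝c , ⌜ g ⌝c ⟫ ⟫
  ⌜ Mc f ⌝c = ⟪ 6 , ⌜ f ⌝c ⟫

  ⌜_⌝cs : List Code → ℕ
  ⌜ [] ⌝cs = 0
  ⌜ g ∷ gs ⌝cs = suc ⟪ ⌜ g ⌝c , ⌜ gs ⌝cs ⟫

-- Φ e α n v :  Φ_e(α; n) ↓ = v
-- (indices not in the image of the numbering give the nowhere defined function)
Φ : ℕ → Baire → ℕ → ℕ → Set
Φ e α n v = Σ Code (λ c → ⌜ c ⌝c ≡ e × Eval α c (n ∷ []) v)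

_⊢_⇓_ : ℕ → Baire → ℕ → Set
e ⊢ α ⇓ n = Σ ℕ (λ v → Φ e α n v)

Tot : ℕ → Baire → Set
Tot e α = ∀ n → e ⊢ α ⇓ n

_⊢_↦_ : ℕ → Baire → Baire → Set
e ⊢ α ↦ β = ∀ n → Φ e α n (β n)

-- ⟨ x , y ⟩ (2n) = x n ,  ⟨ x , y ⟩ (2n+1) = y n
⟨_,_⟩ : Baire → Baire → Baire
⟨ x , y ⟩ zero = x zero
⟨ x , y ⟩ (suc zero) = y zero
⟨ x , y ⟩ (suc (suc n)) = ⟨ (λ k → x (suc k)) , (λ k → y (suc k)) ⟩ n

π₁ π₂ : Baire → Baire
π₁ z n = z (n + n)
π₂ z n = z (suc (n + n))

-- a natural number b is coded by the constant sequence b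
IsNat : ℕ → Baire → Set
IsNat b z = ∀ n → z n ≡ b

-- Problems (partial multi-valued functions on Baire space, on codes)

record Problem : Set₁ where
  field
    dom : Baire → Set
    sol : Baire → Baire → Set
open Problem public

Realizer : Problem → (Baire → Baire) → Set
Realizer G q = ∀ x → dom G x → sol G x (q x)

-- Weihrauch reducibility, H = Φ_h, K = Φ_k. Realizers are partial in the
-- paper; q(H x) must be defined for every realizer, so H x ∈ dom G.
_≤W_ : Problem → Problem → Set
F ≤W G = Σ ℕ λ h → Σ ℕ λ k →
  ∀ x → dom F x → ∀ (q : Baire → Baire) → Realizer G q →
    Σ Baire λ y → (h ⊢ x ↦ y) × dom G y ×
      Σ Baire λ z → (k ⊢ ⟨ x , q y ⟩ ↦ z) × sol F x z

Unique : Problem → Problem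
dom (Unique F) x = dom F x × Σ Baire (λ z → sol F x z × (∀ z' → sol F x z' → z' ≈B z))
sol (Unique F) = sol F

-- Δ⁰₂-LEM.  Input (i , j , p) is coded as ⟨ i , ⟨ j , p ⟩ ⟩ with i, j constant.

Δ⁰₂-LEM : Problem
dom Δ⁰₂-LEM x =
  IsNat (π₁ x 0) (π₁ x) × IsNat (π₁ (π₂ x) 0) (π₁ (π₂ x)) ×
  (∀ α → (Tot (π₁ x 0) α → ¬ Tot (π₁ (π₂ x) 0) α) ×
         (¬ Tot (π₁ (π₂ x) 0) α → Tot (π₁ x 0) α))
sol Δ⁰₂-LEM x z =
  (Tot (π₁ x 0) (π₂ (π₂ x)) × IsNat 0 z) ⊎ (¬ Tot (π₁ x 0) (π₂ (π₂ x)) × IsNat 1 z)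

-- Σ⁰₂-LLPO.  Input (p₀ , p₁) is coded as ⟨ p₀ , p₁ ⟩.

InfZero : Baire → Set
InfZero p = ∀ n → Σ ℕ λ m → n ≤ m × p m ≡ 0

Σ⁰₂-LLPO : Problem
dom Σ⁰₂-LLPO y = InfZero (π₁ y) ⊎ InfZero (π₂ y)
sol Σ⁰₂-LLPO y z = (InfZero (π₁ y) × IsNat 0 z) ⊎ (InfZero (π₂ y) × IsNat 1 z)

module Submission where

-- Totality of Φ_e(p) is uniformly Π⁰₂: "Φ_e(p; n) has a computation log coded below s" is
-- expressed by a formula with bounded quantifiers only, hence is decidable by a code.  So the
-- length of agreement ℓ_e(s) (the least m ≤ s such that m = s or some n ≤ m has no log below s)
-- is computable, nondecreasing in s, and grows infinitely often exactly when p ∈ Tot_e.  Given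
-- (i, j, p), interleave the two sequences that are 0 at the stages where ℓ_i resp. ℓ_j grows.
-- As Tot_i and Tot_j are complementary, exactly one side has infinitely many zeros, so this
-- Σ⁰₂-LLPO instance has a unique answer, and that answer decides p ∈ Tot_i.  Excluded middle
-- is needed only to exhibit the unique answer, as membership in the domain of Unique demands.

open import Defs
open import Level using (0ℓ)
open import Axiom.ExcludedMiddle using (ExcludedMiddle)
open import Data.Product using (_,_)

module Numbering where

  open import Data.Nat
  open import Data.Nat.Properties
  open import Data.Product using (Σ; _×_; _,_; proj₁; proj₂)
  open import Data.Empty using (⊥-elim)
  open import Data.List using ([]; _∷_)
  open import Relation.Binary.PropositionalEquality

  ⟪suc,⟫ : ∀ a b → ⟪ suc a , b ⟫ ≡ 2 * ⟪ a , b ⟫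
  ⟪suc,⟫ a b = *-assoc 2 (2 ^ a) (2 * b + 1)

  ⟪zero,⟫ : ∀ b → ⟪ 0 , b ⟫ ≡ 2 * b + 1
  ⟪zero,⟫ b = +-identityʳ (2 * b + 1)

  2*≢2*+1 : ∀ x y → 2 * x ≢ 2 * y + 1
  2*≢2*+1 x y eq = even≢odd x y (trans eq (+-comm (2 * y) 1))

  double≢suc-double : ∀ x y → x + x ≢ suc (y + y)
  double≢suc-double x y eq = even≢odd x y (trans (2*≡+ x) (trans eq (cong suc (sym (2*≡+ y)))))
    where
    2*≡+ : ∀ x → 2 * x ≡ x + x
    2*≡+ x = cong (x +_) (+-identityʳ x)

  ⟪⟫-injective : ∀ a b a' b' → ⟪ a , b ⟫ ≡ ⟪ a' , b' ⟫ → a ≡ a' × b ≡ b'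
  ⟪⟫-injective zero b zero b' eq = refl , *-cancelˡ-≡ b b' 2
    (+-cancelʳ-≡ 1 _ _ (trans (sym (⟪zero,⟫ b)) (trans eq (⟪zero,⟫ b'))))
  ⟪⟫-injective zero b (suc a') b' eq =
    ⊥-elim (2*≢2*+1 ⟪ a' , b' ⟫ b (sym (trans (sym (⟪zero,⟫ b)) (trans eq (⟪suc,⟫ a' b')))))
  ⟪⟫-injective (suc a) b zero b' eq =
    ⊥-elim (2*≢2*+1 ⟪ a , b ⟫ b' (trans (sym (⟪suc,⟫ a b)) (trans eq (⟪zero,⟫ b'))))
  ⟪⟫-injective (suc a) b (suc a') b' eq with ⟪⟫-injective a b a' b'
    (*-cancelˡ-≡ _ _ 2 (trans (sym (⟪suc,⟫ a b)) (trans eq (⟪suc,⟫ a' b'))))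
  ... | refl , refl = refl , refl

  n<2^n : ∀ a → a < 2 ^ a
  n<2^n zero = s≤s z≤n
  n<2^n (suc a) = +-mono-≤-< (m^n>0 2 a) (≤-trans (n<2^n a) (m≤m+n (2 ^ a) 0))

  fst<⟪⟫ : ∀ a b → a < ⟪ a , b ⟫
  fst<⟪⟫ a b = <-≤-trans (n<2^n a) (m≤m*n (2 ^ a) (2 * b + 1) {{ odd-nonZero }})
    where
    odd-nonZero : NonZero (2 * b + 1)
    odd-nonZero rewrite +-comm (2 * b) 1 = _

  snd<⟪⟫ : ∀ a b → b < ⟪ a , b ⟫
  snd<⟪⟫ a b = ≤-trans b<2b+1 (m≤n*m (2 * b + 1) (2 ^ a) {{ m^n≢0 2 a }})
    where
    b<2b+1 : suc b ≤ 2 * b + 1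
    b<2b+1 rewrite +-comm (2 * b) 1 = s≤s (m≤m+n b (b + 0))

  tag : Code → ℕ
  tag Zc = 0
  tag Sc = 1
  tag (Pc i) = 2
  tag Oc = 3
  tag (Cc f gs) = 4
  tag (Rc f g) = 5
  tag (Mc f) = 6
  body : Code → ℕ
  body Zc = 0
  body Sc = 0
  body (Pc i) = i
  body Oc = 0
  body (Cc f gs) = ⟪ ⌜ f ⌝c , ⌜ gs ⌝cs ⟫
  body (Rc f g) = ⟪ ⌜ f ⌝c , ⌜ g ⌝c ⟫
  body (Mc f) = ⌜ f ⌝c

  ⌜⌝c≡⟪tag,body⟫ : ∀ c → ⌜ c ⌝c ≡ ⟪ tag c , body c ⟫
  ⌜⌝c≡⟪tag,body⟫ Zc = refl
  ⌜⌝c≡⟪tag,body⟫ Sc = refl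
  ⌜⌝c≡⟪tag,body⟫ (Pc i) = refl
  ⌜⌝c≡⟪tag,body⟫ Oc = refl
  ⌜⌝c≡⟪tag,body⟫ (Cc f gs) = refl
  ⌜⌝c≡⟪tag,body⟫ (Rc f g) = refl
  ⌜⌝c≡⟪tag,body⟫ (Mc f) = refl

  mutual
    ⌜⌝c-injective : ∀ c c' → ⌜ c ⌝c ≡ ⌜ c' ⌝c → c ≡ c'
    ⌜⌝c-injective c c' e = go c c' (⟪⟫-injective (tag c) (body c) (tag c') (body c')
      (trans (sym (⌜⌝c≡⟪tag,body⟫ c)) (trans e (⌜⌝c≡⟪tag,body⟫ c'))))
      where
      go : ∀ c c' → tag c ≡ tag c' × body c ≡ body c' → c ≡ c'
      go Zc Zc _ = refl
      go Zc Sc (() , _)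
      go Zc (Pc i') (() , _)
      go Zc Oc (() , _)
      go Zc (Cc f' gs') (() , _)
      go Zc (Rc f' g') (() , _)
      go Zc (Mc f') (() , _)
      go Sc Zc (() , _)
      go Sc Sc _ = refl
      go Sc (Pc i') (() , _)
      go Sc Oc (() , _)
      go Sc (Cc f' gs') (() , _)
      go Sc (Rc f' g') (() , _)
      go Sc (Mc f') (() , _)
      go (Pc i) Zc (() , _)
      go (Pc i) Sc (() , _)
      go (Pc i) (Pc i') (refl , e2) = cong Pc e2
      go (Pc i) Oc (() , _)
      go (Pc i) (Cc f' gs') (() , _)
      go (Pc i) (Rc f' g') (() , _)
      go (Pc i) (Mc f') (() , _)
      go Oc Zc (() , _)
      go Oc Sc (() , _)
      go Oc (Pc i') (() , _)
      go Oc Oc _ = refl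
      go Oc (Cc f' gs') (() , _)
      go Oc (Rc f' g') (() , _)
      go Oc (Mc f') (() , _)
      go (Cc f gs) Zc (() , _)
      go (Cc f gs) Sc (() , _)
      go (Cc f gs) (Pc i') (() , _)
      go (Cc f gs) Oc (() , _)
      go (Cc f gs) (Cc f' gs') (refl , e2) = cong₂ Cc (⌜⌝c-injective f f' (proj₁ (⟪⟫-injective ⌜ f ⌝c ⌜ gs ⌝cs ⌜ f' ⌝c ⌜ gs' ⌝cs e2))) (⌜⌝cs-injective gs gs' (proj₂ (⟪⟫-injective ⌜ f ⌝c ⌜ gs ⌝cs ⌜ f' ⌝c ⌜ gs' ⌝cs e2)))
      go (Cc f gs) (Rc f' g') (() , _)
      go (Cc f gs) (Mc f') (() , _)
      go (Rc f g) Zc (() , _)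
      go (Rc f g) Sc (() , _)
      go (Rc f g) (Pc i') (() , _)
      go (Rc f g) Oc (() , _)
      go (Rc f g) (Cc f' gs') (() , _)
      go (Rc f g) (Rc f' g') (refl , e2) = cong₂ Rc (⌜⌝c-injective f f' (proj₁ (⟪⟫-injective ⌜ f ⌝c ⌜ g ⌝c ⌜ f' ⌝c ⌜ g' ⌝c e2))) (⌜⌝c-injective g g' (proj₂ (⟪⟫-injective ⌜ f ⌝c ⌜ g ⌝c ⌜ f' ⌝c ⌜ g' ⌝c e2)))
      go (Rc f g) (Mc f') (() , _)
      go (Mc f) Zc (() , _)
      go (Mc f) Sc (() , _)
      go (Mc f) (Pc i') (() , _)
      go (Mc f) Oc (() , _)
      go (Mc f) (Cc f' gs') (() , _)
      go (Mc f) (Rc f' g') (() , _)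
      go (Mc f) (Mc f') (refl , e2) = cong Mc (⌜⌝c-injective f f' e2)

    ⌜⌝cs-injective : ∀ gs gs' → ⌜ gs ⌝cs ≡ ⌜ gs' ⌝cs → gs ≡ gs'
    ⌜⌝cs-injective [] [] e = refl
    ⌜⌝cs-injective [] (g ∷ gs') ()
    ⌜⌝cs-injective (g ∷ gs) [] ()
    ⌜⌝cs-injective (g ∷ gs) (g' ∷ gs') e with ⟪⟫-injective ⌜ g ⌝c ⌜ gs ⌝cs ⌜ g' ⌝c ⌜ gs' ⌝cs (suc-injective e)
    ... | e1 , e2 = cong₂ _∷_ (⌜⌝c-injective g g' e1) (⌜⌝cs-injective gs gs' e2)

  tag≡5⇒Rc : ∀ c → tag c ≡ 5 → Σ Code λ f → Σ Code λ g → c ≡ Rc f g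
  tag≡5⇒Rc Zc ()
  tag≡5⇒Rc Sc ()
  tag≡5⇒Rc (Pc i) ()
  tag≡5⇒Rc Oc ()
  tag≡5⇒Rc (Cc f gs) ()
  tag≡5⇒Rc (Rc f g) _ = f , g , refl
  tag≡5⇒Rc (Mc f) ()

  fst≤⟪⟫ : ∀ a b → a ≤ ⟪ a , b ⟫
  fst≤⟪⟫ a b = <⇒≤ (fst<⟪⟫ a b)

  snd≤⟪⟫ : ∀ a b → b ≤ ⟪ a , b ⟫
  snd≤⟪⟫ a b = <⇒≤ (snd<⟪⟫ a b)


module PrimitiveRecursion where

  open import Data.Nat
  open import Data.Nat.Properties
  open import Data.Bool using (Bool; true; false; if_then_else_)
  open import Data.Vec using (Vec; []; _∷_; head; tail; lookup; toList)
  open import Data.Fin using (Fin; zero; suc; toℕ)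
  open import Data.List using (List; []; _∷_)
  open import Data.Product using (Σ; _,_)
  open import Relation.Binary.PropositionalEquality

  Computes : (k : ℕ) → (Baire → Vec ℕ k → ℕ) → Set
  Computes k F = Σ Code λ c → ∀ α v → Eval α c (toList v) (F α v)

  record PR (k : ℕ) : Set where
    constructor mkPR
    field
      fn : Baire → Vec ℕ k → ℕ
      prf : Computes k fn
  open PR public

  record PRs (k m : ℕ) : Set where
    constructor mkPRs
    field
      fns : Baire → Vec ℕ k → Vec ℕ m
      cds : List Code
      oks : ∀ α v → EvalList α cds (toList v) (toList (fns α v))
  open PRs public

  PR-ext : ∀ {k} (p : PR k) (F : Baire → Vec ℕ k → ℕ) → (∀ α v → fn p α v ≡ F α v) → PR k
  PR-ext (mkPR f (c , o)) F e = mkPR F (c , λ α v → subst (Eval α c (toList v)) (e α v) (o α v))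

  cZ : ∀ {k} → PR k
  cZ = mkPR (λ _ _ → 0) (Zc , λ α v → ev-Z)

  cS : ∀ {k} → PR (suc k)
  cS = mkPR (λ _ v → suc (head v)) (Sc , λ { α (x ∷ v) → ev-S })

  nth-lookup : ∀ {k} (v : Vec ℕ k) (i : Fin k) → Nth (toℕ i) (toList v) (lookup v i)
  nth-lookup (x ∷ v) zero = here
  nth-lookup (x ∷ v) (suc i) = there (nth-lookup v i)

  cP : ∀ {k} → Fin k → PR k
  cP i = mkPR (λ _ v → lookup v i) (Pc (toℕ i) , λ α v → ev-P (nth-lookup v i))

  cO : ∀ {k} → PR (suc k)
  cO = mkPR (λ α v → α (head v)) (Oc , λ { α (x ∷ v) → ev-O })

  nilP : ∀ {k} → PRs k 0
  nilP = mkPRs (λ _ _ → []) [] (λ α v → evl-[])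

  _∷P_ : ∀ {k m} → PR k → PRs k m → PRs k (suc m)
  mkPR f (c , o) ∷P mkPRs fs cs os = mkPRs (λ α v → f α v ∷ fs α v) (c ∷ cs) (λ α v → evl-∷ (o α v) (os α v))
  infixr 5 _∷P_

  cC : ∀ {k m} → PR m → PRs k m → PR k
  cC (mkPR g (c , o)) (mkPRs fs cs os) = mkPR (λ α v → g α (fs α v)) (Cc c cs , λ α v → ev-C (os α v) (o α (fs α v)))

  precF : ∀ {k} → (Baire → Vec ℕ k → ℕ) → (Baire → Vec ℕ (suc (suc k)) → ℕ) → Baire → ℕ → Vec ℕ k → ℕ
  precF f g α zero v = f α v
  precF f g α (suc n) v = g α (n ∷ precF f g α n v ∷ v)

  cR : ∀ {k} → PR k → PR (suc (suc k)) → PR (suc k)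
  cR {k} (mkPR f (cf , of)) (mkPR g (cg , og)) = mkPR (λ α v → precF f g α (head v) (tail v)) (Rc cf cg , λ { α (n ∷ v) → go α n v })
    where
    go : ∀ α n v → Eval α (Rc cf cg) (n ∷ toList v) (precF f g α n v)
    go α zero v = ev-R0 (of α v)
    go α (suc n) v = ev-RS (go α n v) (og α (n ∷ precF f g α n v ∷ v))

  constP : ∀ {k} → ℕ → PR k
  constP zero = cZ
  constP (suc n) = cC cS (constP n ∷P nilP)

  v0 : ∀ {k} → PR (suc k)
  v0 = cP zero
  v1 : ∀ {k} → PR (suc (suc k))
  v1 = cP (suc zero)
  v2 : ∀ {k} → PR (suc (suc (suc k)))
  v2 = cP (suc (suc zero))

  bin : (ℕ → ℕ → ℕ) → Baire → Vec ℕ 2 → ℕ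
  bin f _ (x ∷ y ∷ []) = f x y

  addP : PR 2
  addP = PR-ext b (bin _+_) λ { α (x ∷ y ∷ []) → go α x y }
    where b : PR 2
          b = cR (cP zero) (cC cS (v1 ∷P nilP))
          go : ∀ α x y → fn b α (x ∷ y ∷ []) ≡ x + y
          go α zero y = refl
          go α (suc x) y = cong suc (go α x y)

  mulP : PR 2
  mulP = PR-ext b (bin _*_) λ { α (x ∷ y ∷ []) → go α x y }
    where b : PR 2
          b = cR cZ (cC addP (v2 ∷P v1 ∷P nilP))
          go : ∀ α x y → fn b α (x ∷ y ∷ []) ≡ x * y
          go α zero y = refl
          go α (suc x) y = cong (y +_) (go α x y)

  pow2P : PR 1
  pow2P = PR-ext b (λ _ v → 2 ^ head v) λ { α (x ∷ []) → go α x }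
    where b : PR 1
          b = cR (constP 1) (cC mulP (constP 2 ∷P v1 ∷P nilP))
          go : ∀ α x → fn b α (x ∷ []) ≡ 2 ^ x
          go α zero = refl
          go α (suc x) = cong (2 *_) (go α x)

  pairP : PR 2
  pairP = cC mulP (cC pow2P (v0 ∷P nilP) ∷P cC addP (cC mulP (constP 2 ∷P v1 ∷P nilP) ∷P constP 1 ∷P nilP) ∷P nilP)

  predP : PR 1
  predP = PR-ext (cR cZ v0) (λ _ v → pred (head v)) λ { α (zero ∷ []) → refl ; α (suc x ∷ []) → refl }

  monusR : PR 2
  monusR = PR-ext b (bin λ y x → x ∸ y) λ { α (y ∷ x ∷ []) → go α y x }
    where b : PR 2
          b = cR v0 (cC predP (v1 ∷P nilP))
          go : ∀ α y x → fn b α (y ∷ x ∷ []) ≡ x ∸ y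
          go α zero x = refl
          go α (suc y) x = trans (cong pred (go α y x)) (pred[m∸n]≡m∸[1+n] x y)

  monusP : PR 2
  monusP = cC monusR (v1 ∷P v0 ∷P nilP)

  b2n : Bool → ℕ
  b2n true = 1
  b2n false = 0

  isZ : ℕ → ℕ
  isZ zero = 1
  isZ (suc _) = 0

  isZP : PR 1
  isZP = PR-ext (cR (constP 1) cZ) (λ _ v → isZ (head v)) λ { α (zero ∷ []) → refl ; α (suc x ∷ []) → refl }

  eqbP : PR 2
  eqbP = PR-ext (cC isZP (cC addP (monusP ∷P cC monusP (v1 ∷P v0 ∷P nilP) ∷P nilP) ∷P nilP))
             (bin λ x y → b2n (x ≡ᵇ y)) λ { α (x ∷ y ∷ []) → go x y }
    where go : ∀ x y → isZ ((x ∸ y) + (y ∸ x)) ≡ b2n (x ≡ᵇ y)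
          go zero zero = refl
          go zero (suc y) = refl
          go (suc x) zero = refl
          go (suc x) (suc y) = go x y

  andP : PR 2
  andP = PR-ext (cR cZ v2) (bin λ x y → if x ≡ᵇ 0 then 0 else y) λ { α (zero ∷ y ∷ []) → refl ; α (suc x ∷ y ∷ []) → refl }

  orP : PR 2
  orP = PR-ext (cR v0 (constP 1)) (bin λ x y → if x ≡ᵇ 0 then y else 1) λ { α (zero ∷ y ∷ []) → refl ; α (suc x ∷ y ∷ []) → refl }

  notP : PR 1
  notP = isZP

  iteP : PR 3
  iteP = PR-ext (cR v1 v2) (λ _ v → ite3 v) λ { α (zero ∷ a ∷ b ∷ []) → refl ; α (suc x ∷ a ∷ b ∷ []) → refl }
    where ite3 : Vec ℕ 3 → ℕ
          ite3 (c ∷ a ∷ b ∷ []) = if c ≡ᵇ 0 then b else a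


module BoundedFormulas where

  open PrimitiveRecursion
  open import Data.Nat
  open import Data.Nat.Properties
  open import Data.Bool using (Bool; true; false; _∧_; _∨_; not; if_then_else_)
  open import Data.Bool.Properties using (∨-zeroʳ)
  open import Data.Vec using (Vec; []; _∷_; lookup)
  open import Data.Fin using (Fin; zero; suc)
  open import Data.List using ([]; _∷_)
  open import Data.Product using (Σ; _×_; _,_)
  open import Data.Sum using (_⊎_; inj₁; inj₂)
  open import Data.Empty using (⊥-elim)
  open import Relation.Nullary using (¬_)
  open import Relation.Binary.PropositionalEquality

  mutual
    data Tm (k : ℕ) : Set where
      var : Fin k → Tm k
      lit : ℕ → Tm k
      sc : Tm k → Tm k
      add : Tm k → Tm k → Tm k
      pr : Tm k → Tm k → Tm k
      ora : Tm k → Tm k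
      mu : Tm k → Fm (suc k) → Tm k
      itr : Tm 1 → Tm k → Tm k → Tm k
      app1 : Tm 1 → Tm k → Tm k
      ind : Fm k → Tm k

    data Fm (k : ℕ) : Set where
      eq : Tm k → Tm k → Fm k
      and : Fm k → Fm k → Fm k
      or : Fm k → Fm k → Fm k
      neg : Fm k → Fm k
      ex : Tm k → Fm (suc k) → Fm k
      all : Tm k → Fm (suc k) → Fm k
      appF : ∀ {j} → Fm j → Vec (Tm k) j → Fm k

  anyB : (ℕ → Bool) → ℕ → Bool
  anyB p zero = false
  anyB p (suc n) = anyB p n ∨ p n

  allB : (ℕ → Bool) → ℕ → Bool
  allB p zero = true
  allB p (suc n) = allB p n ∧ p n

  muN : (ℕ → Bool) → ℕ → ℕ
  muN p zero = 0
  muN p (suc n) = if anyB p n then muN p n else (if p n then n else 0)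

  iterN : (ℕ → ℕ) → ℕ → ℕ → ℕ
  iterN g zero a = a
  iterN g (suc n) a = g (iterN g n a)

  mutual
    ⟦_⟧ : ∀ {k} → Tm k → Baire → Vec ℕ k → ℕ
    ⟦ var i ⟧ α v = lookup v i
    ⟦ lit n ⟧ α v = n
    ⟦ sc t ⟧ α v = suc (⟦ t ⟧ α v)
    ⟦ add a b ⟧ α v = ⟦ a ⟧ α v + ⟦ b ⟧ α v
    ⟦ pr a b ⟧ α v = ⟪ ⟦ a ⟧ α v , ⟦ b ⟧ α v ⟫
    ⟦ ora t ⟧ α v = α (⟦ t ⟧ α v)
    ⟦ mu b φ ⟧ α v = muN (λ y → ev φ α (y ∷ v)) (⟦ b ⟧ α v)
    ⟦ itr f n a ⟧ α v = iterN (λ z → ⟦ f ⟧ α (z ∷ [])) (⟦ n ⟧ α v) (⟦ a ⟧ α v)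
    ⟦ app1 f a ⟧ α v = ⟦ f ⟧ α (⟦ a ⟧ α v ∷ [])
    ⟦ ind φ ⟧ α v = b2n (ev φ α v)

    ⟦_⟧s : ∀ {k j} → Vec (Tm k) j → Baire → Vec ℕ k → Vec ℕ j
    ⟦ [] ⟧s α v = []
    ⟦ t ∷ ts ⟧s α v = ⟦ t ⟧ α v ∷ ⟦ ts ⟧s α v

    ev : ∀ {k} → Fm k → Baire → Vec ℕ k → Bool
    ev (eq a b) α v = ⟦ a ⟧ α v ≡ᵇ ⟦ b ⟧ α v
    ev (and φ ψ) α v = ev φ α v ∧ ev ψ α v
    ev (or φ ψ) α v = ev φ α v ∨ ev ψ α v
    ev (neg φ) α v = not (ev φ α v)
    ev (ex b φ) α v = anyB (λ y → ev φ α (y ∷ v)) (⟦ b ⟧ α v)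
    ev (all b φ) α v = allB (λ y → ev φ α (y ∷ v)) (⟦ b ⟧ α v)
    ev (appF φ ts) α v = ev φ α (⟦ ts ⟧s α v)

  Sat : ∀ {k} → Fm k → Baire → Vec ℕ k → Set
  Sat (eq a b) α v = ⟦ a ⟧ α v ≡ ⟦ b ⟧ α v
  Sat (and φ ψ) α v = Sat φ α v × Sat ψ α v
  Sat (or φ ψ) α v = Sat φ α v ⊎ Sat ψ α v
  Sat (neg φ) α v = ¬ Sat φ α v
  Sat (ex b φ) α v = Σ ℕ λ y → y < ⟦ b ⟧ α v × Sat φ α (y ∷ v)
  Sat (all b φ) α v = ∀ y → y < ⟦ b ⟧ α v → Sat φ α (y ∷ v)
  Sat (appF φ ts) α v = Sat φ α (⟦ ts ⟧s α v)

  ≡ᵇ-true⇒≡ : ∀ m n → (m ≡ᵇ n) ≡ true → m ≡ n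
  ≡ᵇ-true⇒≡ zero zero _ = refl
  ≡ᵇ-true⇒≡ (suc m) (suc n) e = cong suc (≡ᵇ-true⇒≡ m n e)
  ≡ᵇ-true⇒≡ zero (suc n) ()
  ≡ᵇ-true⇒≡ (suc m) zero ()

  ≡⇒≡ᵇ-true : ∀ m n → m ≡ n → (m ≡ᵇ n) ≡ true
  ≡⇒≡ᵇ-true zero .zero refl = refl
  ≡⇒≡ᵇ-true (suc m) .(suc m) refl = ≡⇒≡ᵇ-true m m refl

  ∨-true : ∀ a b → (a ∨ b) ≡ true → a ≡ true ⊎ b ≡ true
  ∨-true true b _ = inj₁ refl
  ∨-true false b e = inj₂ e

  anyB→ : ∀ p n → anyB p n ≡ true → Σ ℕ λ y → y < n × p y ≡ true
  anyB→ p zero ()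
  anyB→ p (suc n) e with ∨-true (anyB p n) (p n) e
  ... | inj₁ e' = let (y , l , q) = anyB→ p n e' in y , m≤n⇒m≤1+n l , q
  ... | inj₂ e' = n , ≤-refl , e'

  →anyB : ∀ p n y → y < n → p y ≡ true → anyB p n ≡ true
  →anyB p (suc n) y l q with m≤n⇒m<n∨m≡n (s≤s⁻¹ l)
  ... | inj₁ l' = cong (_∨ p n) (→anyB p n y l' q)
  ... | inj₂ refl rewrite q = ∨-zeroʳ (anyB p y)

  ∧-true : ∀ a b → (a ∧ b) ≡ true → a ≡ true × b ≡ true
  ∧-true true true _ = refl , refl
  ∧-true true false ()
  ∧-true false b ()

  allB→ : ∀ p n → allB p n ≡ true → ∀ y → y < n → p y ≡ true
  allB→ p (suc n) e y l with ∧-true (allB p n) (p n) e | m≤n⇒m<n∨m≡n (s≤s⁻¹ l)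
  ... | e1 , e2 | inj₁ l' = allB→ p n e1 y l'
  ... | e1 , e2 | inj₂ refl = e2

  →allB : ∀ p n → (∀ y → y < n → p y ≡ true) → allB p n ≡ true
  →allB p zero h = refl
  →allB p (suc n) h rewrite →allB p n (λ y l → h y (m≤n⇒m≤1+n l)) | h n ≤-refl = refl

  anyB-false : ∀ p b → (∀ y → y < b → p y ≡ false) → anyB p b ≡ false
  anyB-false p zero h = refl
  anyB-false p (suc b) h rewrite anyB-false p b (λ y l → h y (m≤n⇒m≤1+n l)) | h b ≤-refl = refl

  mu-zero : ∀ p b → (∀ y → y < b → p y ≡ false) → muN p b ≡ 0
  mu-zero p zero h = refl
  mu-zero p (suc b) h rewrite anyB-false p b (λ y l → h y (m≤n⇒m≤1+n l)) | h b ≤-refl = refl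

  mu-spec : ∀ p b y → p y ≡ true → y < b → p (muN p b) ≡ true × muN p b ≤ y
  mu-spec p (suc b) y py l with anyB p b in ea
  ... | true with m≤n⇒m<n∨m≡n (s≤s⁻¹ l)
  ...   | inj₁ l' = mu-spec p b y py l'
  ...   | inj₂ refl = let (y' , l' , q) = anyB→ p b ea
                          (r1 , r2) = mu-spec p b y' q l' in r1 , ≤-trans r2 (<⇒≤ l')
  mu-spec p (suc b) y py l | false with m≤n⇒m<n∨m≡n (s≤s⁻¹ l)
  ...   | inj₁ l' with trans (sym (→anyB p b y l' py)) ea
  ...     | ()
  mu-spec p (suc b) y py l | false | inj₂ refl rewrite py = py , ≤-refl

  not-true : ∀ b → not b ≡ true → b ≡ false
  not-true false _ = refl
  not-true true ()

  mutual
    ev-sound : ∀ {k} (φ : Fm k) α v → ev φ α v ≡ true → Sat φ α v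
    ev-sound (eq a b) α v e = ≡ᵇ-true⇒≡ _ _ e
    ev-sound (and φ ψ) α v e = let (e1 , e2) = ∧-true _ _ e in ev-sound φ α v e1 , ev-sound ψ α v e2
    ev-sound (or φ ψ) α v e with ∨-true (ev φ α v) _ e
    ... | inj₁ e' = inj₁ (ev-sound φ α v e')
    ... | inj₂ e' = inj₂ (ev-sound ψ α v e')
    ev-sound (neg φ) α v e s with trans (sym (ev-complete φ α v s)) (not-true _ e)
    ... | ()
    ev-sound (ex b φ) α v e = let (y , l , q) = anyB→ _ _ e in y , l , ev-sound φ α (y ∷ v) q
    ev-sound (all b φ) α v e y l = ev-sound φ α (y ∷ v) (allB→ _ _ e y l)
    ev-sound (appF φ ts) α v e = ev-sound φ α (⟦ ts ⟧s α v) e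

    ev-complete : ∀ {k} (φ : Fm k) α v → Sat φ α v → ev φ α v ≡ true
    ev-complete (eq a b) α v s = ≡⇒≡ᵇ-true _ _ s
    ev-complete (and φ ψ) α v (s1 , s2) rewrite ev-complete φ α v s1 | ev-complete ψ α v s2 = refl
    ev-complete (or φ ψ) α v (inj₁ s) rewrite ev-complete φ α v s = refl
    ev-complete (or φ ψ) α v (inj₂ s) rewrite ev-complete ψ α v s = ∨-zeroʳ (ev φ α v)
    ev-complete (neg φ) α v s with ev φ α v in eqn
    ... | true = ⊥-elim (s (ev-sound φ α v eqn))
    ... | false = refl
    ev-complete (ex b φ) α v (y , l , s) = →anyB _ _ y l (ev-complete φ α (y ∷ v) s)
    ev-complete (all b φ) α v h = →allB _ _ λ y l → ev-complete φ α (y ∷ v) (h y l)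
    ev-complete (appF φ ts) α v s = ev-complete φ α (⟦ ts ⟧s α v) s


module FormulaCompilation where

  open PrimitiveRecursion
  open BoundedFormulas
  open import Data.Nat
  open import Data.Nat.Properties
  open import Data.Bool using (Bool; true; false; _∧_; _∨_; not; if_then_else_)
  open import Data.Vec using (Vec; []; _∷_; head; tail; lookup; tabulate)
  open import Data.Vec.Properties using (tabulate∘lookup)
  open import Data.Fin using (Fin; zero; suc)
  open import Data.List using ([]; _∷_)
  open import Data.Product using (Σ; _,_)
  open import Relation.Binary.PropositionalEquality

  projsT : ∀ {k m} → (Fin m → Fin k) → PRs k m
  projsT {m = zero} ρ = nilP
  projsT {m = suc m} ρ = cP (ρ zero) ∷P projsT (λ i → ρ (suc i))

  projsT-fn : ∀ {k m} (ρ : Fin m → Fin k) α v → fns (projsT ρ) α v ≡ tabulate (λ i → lookup v (ρ i))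
  projsT-fn {m = zero} ρ α v = refl
  projsT-fn {m = suc m} ρ α v = cong (lookup v (ρ zero) ∷_) (projsT-fn (λ i → ρ (suc i)) α v)

  idsP : ∀ {k} → PRs k k
  idsP = projsT (λ i → i)

  idsP-fn : ∀ {k} α (v : Vec ℕ k) → fns idsP α v ≡ v
  idsP-fn α v = trans (projsT-fn (λ i → i) α v) (tabulate∘lookup v)

  dropP : ∀ {k} → PRs (suc (suc k)) (suc k)
  dropP = cP zero ∷P projsT (λ i → suc (suc i))

  dropT-fn : ∀ {k} α y w (v : Vec ℕ k) → fns (projsT (λ i → suc (suc i))) α (y ∷ w ∷ v) ≡ v
  dropT-fn α y w v = trans (projsT-fn (λ i → suc (suc i)) α (y ∷ w ∷ v)) (tabulate∘lookup v)

  anyP : ∀ {k} (P : Baire → Vec ℕ (suc k) → Bool) → Computes (suc k) (λ α v → b2n (P α v)) →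
         Computes (suc k) (λ α v → b2n (anyB (λ y → P α (y ∷ tail v)) (head v)))
  anyP {k} P φ = prf (PR-ext base _ λ { α (n ∷ v) → go α n v })
    where
    φP = mkPR _ φ
    base = cR cZ (cC orP (v1 ∷P cC φP dropP ∷P nilP))
    lem : ∀ a b → (if b2n a ≡ᵇ 0 then b2n b else 1) ≡ b2n (a ∨ b)
    lem true b = refl
    lem false b = refl
    go : ∀ α n v → fn base α (n ∷ v) ≡ b2n (anyB (λ y → P α (y ∷ v)) n)
    go α zero v = refl
    go α (suc n) v rewrite dropT-fn α n (fn base α (n ∷ v)) v | go α n v = lem (anyB (λ y → P α (y ∷ v)) n) (P α (n ∷ v))

  allP : ∀ {k} (P : Baire → Vec ℕ (suc k) → Bool) → Computes (suc k) (λ α v → b2n (P α v)) →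
         Computes (suc k) (λ α v → b2n (allB (λ y → P α (y ∷ tail v)) (head v)))
  allP {k} P φ = prf (PR-ext base _ λ { α (n ∷ v) → go α n v })
    where
    φP = mkPR _ φ
    base = cR (constP 1) (cC andP (v1 ∷P cC φP dropP ∷P nilP))
    lem : ∀ a b → (if b2n a ≡ᵇ 0 then 0 else b2n b) ≡ b2n (a ∧ b)
    lem true b = refl
    lem false b = refl
    go : ∀ α n v → fn base α (n ∷ v) ≡ b2n (allB (λ y → P α (y ∷ v)) n)
    go α zero v = refl
    go α (suc n) v rewrite dropT-fn α n (fn base α (n ∷ v)) v | go α n v = lem (allB (λ y → P α (y ∷ v)) n) (P α (n ∷ v))

  muP : ∀ {k} (P : Baire → Vec ℕ (suc k) → Bool) → Computes (suc k) (λ α v → b2n (P α v)) →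
         Computes (suc k) (λ α v → muN (λ y → P α (y ∷ tail v)) (head v))
  muP {k} P φ = prf (PR-ext base _ λ { α (n ∷ v) → go α n v })
    where
    φP = mkPR _ φ
    aP = mkPR _ (anyP P φ)
    base = cR cZ (cC iteP (cC aP dropP ∷P v1 ∷P cC iteP (cC φP dropP ∷P v0 ∷P cZ ∷P nilP) ∷P nilP))
    lem : ∀ (a : Bool) (x y : ℕ) → (if b2n a ≡ᵇ 0 then y else x) ≡ (if a then x else y)
    lem true x y = refl
    lem false x y = refl
    go : ∀ α n v → fn base α (n ∷ v) ≡ muN (λ y → P α (y ∷ v)) n
    go α zero v = refl
    go α (suc n) v rewrite dropT-fn α n (fn base α (n ∷ v)) v | go α n v
      | lem (P α (n ∷ v)) n 0 = lem (anyB (λ y → P α (y ∷ v)) n) _ _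

  itrP : ∀ (F : Baire → Vec ℕ 1 → ℕ) → Computes 1 F →
         Computes 2 (λ α v → iterN (λ z → F α (z ∷ [])) (head v) (head (tail v)))
  itrP F f = prf (PR-ext base _ λ { α (n ∷ a ∷ []) → go α n a })
    where
    base = cR v0 (cC (mkPR _ f) (v1 ∷P nilP))
    go : ∀ α n a → fn base α (n ∷ a ∷ []) ≡ iterN (λ z → F α (z ∷ [])) n a
    go α zero a = refl
    go α (suc n) a = cong (λ z → F α (z ∷ [])) (go α n a)

  constP-fn : ∀ {k} n α (v : Vec ℕ k) → fn (constP n) α v ≡ n
  constP-fn zero α v = refl
  constP-fn (suc n) α v = cong suc (constP-fn n α v)

  mutual
    Tm-computable : ∀ {k} (t : Tm k) → Computes k ⟦ t ⟧
    Tm-computable (var i) = prf (cP i)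
    Tm-computable (lit n) = prf (PR-ext (constP n) _ (constP-fn n))
    Tm-computable (sc t) = prf (cC cS (mkPR _ (Tm-computable t) ∷P nilP))
    Tm-computable (add a b) = prf (cC addP (mkPR _ (Tm-computable a) ∷P mkPR _ (Tm-computable b) ∷P nilP))
    Tm-computable (pr a b) = prf (cC pairP (mkPR _ (Tm-computable a) ∷P mkPR _ (Tm-computable b) ∷P nilP))
    Tm-computable (ora t) = prf (cC cO (mkPR _ (Tm-computable t) ∷P nilP))
    Tm-computable (mu b φ) = prf (PR-ext (cC (mkPR _ (muP (ev φ) (Fm-computable φ))) (mkPR _ (Tm-computable b) ∷P idsP)) _
      λ α v → cong (λ w → muN (λ y → ev φ α (y ∷ w)) (⟦ b ⟧ α v)) (idsP-fn α v))
    Tm-computable (itr f n a) = prf (cC (mkPR _ (itrP ⟦ f ⟧ (Tm-computable f))) (mkPR _ (Tm-computable n) ∷P mkPR _ (Tm-computable a) ∷P nilP))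
    Tm-computable (app1 f a) = prf (cC (mkPR _ (Tm-computable f)) (mkPR _ (Tm-computable a) ∷P nilP))
    Tm-computable (ind φ) = Fm-computable φ

    Tms-computable : ∀ {k j} (ts : Vec (Tm k) j) → Σ (PRs k j) λ P → ∀ α v → fns P α v ≡ ⟦ ts ⟧s α v
    Tms-computable [] = nilP , λ α v → refl
    Tms-computable (t ∷ ts) = let (P , e) = Tms-computable ts in (mkPR _ (Tm-computable t) ∷P P) , λ α v → cong (⟦ t ⟧ α v ∷_) (e α v)

    Fm-computable : ∀ {k} (φ : Fm k) → Computes k (λ α v → b2n (ev φ α v))
    Fm-computable (eq a b) = prf (cC eqbP (mkPR _ (Tm-computable a) ∷P mkPR _ (Tm-computable b) ∷P nilP))
    Fm-computable (and φ ψ) = prf (PR-ext (cC andP (mkPR _ (Fm-computable φ) ∷P mkPR _ (Fm-computable ψ) ∷P nilP)) _ λ α v → lem (ev φ α v) (ev ψ α v))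
      where lem : ∀ a b → (if b2n a ≡ᵇ 0 then 0 else b2n b) ≡ b2n (a ∧ b)
            lem true b = refl
            lem false b = refl
    Fm-computable (or φ ψ) = prf (PR-ext (cC orP (mkPR _ (Fm-computable φ) ∷P mkPR _ (Fm-computable ψ) ∷P nilP)) _ λ α v → lem (ev φ α v) (ev ψ α v))
      where lem : ∀ a b → (if b2n a ≡ᵇ 0 then b2n b else 1) ≡ b2n (a ∨ b)
            lem true b = refl
            lem false b = refl
    Fm-computable (neg φ) = prf (PR-ext (cC notP (mkPR _ (Fm-computable φ) ∷P nilP)) _ λ α v → lem (ev φ α v))
      where lem : ∀ a → isZ (b2n a) ≡ b2n (not a)
            lem true = refl
            lem false = refl
    Fm-computable (ex b φ) = prf (PR-ext (cC (mkPR _ (anyP (ev φ) (Fm-computable φ))) (mkPR _ (Tm-computable b) ∷P idsP)) _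
      λ α v → cong (λ w → b2n (anyB (λ y → ev φ α (y ∷ w)) (⟦ b ⟧ α v))) (idsP-fn α v))
    Fm-computable (all b φ) = prf (PR-ext (cC (mkPR _ (allP (ev φ) (Fm-computable φ))) (mkPR _ (Tm-computable b) ∷P idsP)) _
      λ α v → cong (λ w → b2n (allB (λ y → ev φ α (y ∷ w)) (⟦ b ⟧ α v))) (idsP-fn α v))
    Fm-computable (appF φ ts) = let (P , e) = Tms-computable ts in
      prf (PR-ext (cC (mkPR _ (Fm-computable φ)) P) _ λ α v → cong (λ w → b2n (ev φ α w)) (e α v))


module ListCoding where

  open Numbering
  open PrimitiveRecursion
  open BoundedFormulas
  open import Data.Nat
  open import Data.Nat.Properties
  open import Data.Bool using (Bool; true)
  open import Data.Vec using ([]; _∷_)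
  open import Data.Fin using (zero; suc)
  open import Data.List using (List; []; _∷_; drop)
  open import Data.List.Properties using (drop-drop)
  open import Data.Product using (_,_; proj₂)
  open import Relation.Binary.PropositionalEquality

  encodeList : List ℕ → ℕ
  encodeList [] = 0
  encodeList (x ∷ xs) = suc ⟪ x , encodeList xs ⟫

  tailTm : Tm 1
  tailTm = mu (sc (var zero)) (ex (sc (var (suc zero))) (eq (var (suc (suc zero))) (sc (pr (var zero) (var (suc zero))))))

  tailCode : Baire → ℕ → ℕ
  tailCode α m = ⟦ tailTm ⟧ α (m ∷ [])

  tailCode-zero : ∀ α → tailCode α 0 ≡ 0
  tailCode-zero α = mu-zero _ 1 λ _ _ → anyB-false _ 1 λ _ _ → refl

  tailCode-cons : ∀ α x r → tailCode α (suc ⟪ x , r ⟫) ≡ r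
  tailCode-cons α x r = let (q , _) = mu-spec P (suc (suc ⟪ x , r ⟫)) r Pr (m<n⇒m<1+n (m<n⇒m<1+n (snd<⟪⟫ x r)))
                            (x' , _ , e) = anyB→ (λ x' → m ≡ᵇ suc ⟪ x' , muN P (suc m) ⟫) (suc m) q
                  in sym (proj₂ (⟪⟫-injective x r x' (muN P (suc m)) (suc-injective (≡ᵇ-true⇒≡ m _ e))))
    where
    m = suc ⟪ x , r ⟫
    P : ℕ → Bool
    P r' = anyB (λ x' → m ≡ᵇ suc ⟪ x' , r' ⟫) (suc m)
    Pr : P r ≡ true
    Pr = →anyB _ (suc m) x (m<n⇒m<1+n (m<n⇒m<1+n (fst<⟪⟫ x r))) (≡⇒≡ᵇ-true m m refl)

  tailCode-encodeList : ∀ α l → tailCode α (encodeList l) ≡ encodeList (drop 1 l)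
  tailCode-encodeList α [] = tailCode-zero α
  tailCode-encodeList α (x ∷ l) = tailCode-cons α x (encodeList l)

  dropCode : Baire → ℕ → ℕ → ℕ
  dropCode α L j = iterN (tailCode α) j L

  dropCode-encodeList : ∀ α i l → dropCode α (encodeList l) i ≡ encodeList (drop i l)
  dropCode-encodeList α zero l = refl
  dropCode-encodeList α (suc i) l = begin
    tailCode α (dropCode α (encodeList l) i)  ≡⟨ cong (tailCode α) (dropCode-encodeList α i l) ⟩
    tailCode α (encodeList (drop i l))        ≡⟨ tailCode-encodeList α (drop i l) ⟩
    encodeList (drop 1 (drop i l))            ≡⟨ cong encodeList (drop-drop i 1 l) ⟩
    encodeList (drop (i + 1) l)               ≡⟨ cong (λ n → encodeList (drop n l)) (+-comm i 1) ⟩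
    encodeList (drop (suc i) l)               ∎
    where open ≡-Reasoning


module ComputationLogs where

  open BoundedFormulas
  open ListCoding
  open import Data.Nat
  open import Data.Fin using (Fin; zero; suc)
  open import Relation.Binary.PropositionalEquality using (_≡_)

  private
    V : ∀ {m} → Fin m → Tm m
    V = var
    ↑ : ∀ {m} → Fin m → Fin (suc m)
    ↑ = suc

  -- A computation log is a coded list of nodes ⟪t, ⟪a, ⟪b, c⟫⟫⟫: for t = 0 the code a maps the
  -- coded input list b to c, for t = 1 the code list a maps b to the coded list c, and for t = 2
  -- and t = 3 the number a is a code resp. a code list.  A node is valid when one evaluation rule
  -- derives it from earlier nodes; all witnesses are below the code of the log, so validity is
  -- a bounded formula.
  nodeCode : ℕ → ℕ → ℕ → ℕ → ℕ
  nodeCode t a b c = ⟪ t , ⟪ a , ⟪ b , c ⟫ ⟫ ⟫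

  NodeIs : Baire → ℕ → ℕ → ℕ → Set
  NodeIs α L j u = dropCode α L j ≡ suc ⟪ u , tailCode α (dropCode α L j) ⟫

  consTm : ∀ {m} → Tm m → Tm m → Tm m
  consTm a b = sc (pr a b)

  nodeTm : ∀ {m} → ℕ → Tm m → Tm m → Tm m → Tm m
  nodeTm t a b c = pr (lit t) (pr a (pr b c))

  tailTm′ : ∀ {m} → Tm m → Tm m
  tailTm′ t = app1 tailTm t

  dropTm : ∀ {m} → Tm m → Tm m → Tm m
  dropTm L j = itr tailTm j L

  NodeAt : ∀ {m} → Tm m → Tm m → Tm m → Fm m
  NodeAt L j u = eq (dropTm L j) (consTm u (tailTm′ (dropTm L j)))

  -- The oracle of Φ_e in an instance α of Δ⁰₂-LEM is π₂ (π₂ α), whose x-th entry is α (4x + 3).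
  inputTm : ∀ {m} → Tm m → Tm m
  inputTm x = ora (sc (add (sc (add x x)) (sc (add x x))))

  EvalRule : ∀ {m} → (L k a xs v : Fin m) → Fm m
  EvalRule L k a xs v = or ZR (or SR (or PcR (or OR (or CR (or RR MR)))))
    where
    ZR = and (eq (V a) (lit ⟪ 0 , 0 ⟫)) (eq (V v) (lit 0))
    SR = and (eq (V a) (lit ⟪ 1 , 0 ⟫)) (ex (sc (V xs)) (let xs = ↑ xs ; v = ↑ v ; x = zero in
           and (eq (V xs) (consTm (V x) (tailTm′ (V xs)))) (eq (V v) (sc (V x)))))
    PcR = ex (sc (V a)) (let a = ↑ a ; xs = ↑ xs ; v = ↑ v ; i = zero in
           and (eq (V a) (pr (lit 2) (V i))) (eq (dropTm (V xs) (V i)) (consTm (V v) (tailTm′ (dropTm (V xs) (V i))))))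
    OR = and (eq (V a) (lit ⟪ 3 , 0 ⟫)) (ex (sc (V xs)) (let xs = ↑ xs ; v = ↑ v ; x = zero in
           and (eq (V xs) (consTm (V x) (tailTm′ (V xs)))) (eq (V v) (inputTm (V x)))))
    CR = ex (sc (V a)) (let L = ↑ L ; k = ↑ k ; a = ↑ a ; xs = ↑ xs ; v = ↑ v ; f = zero in
         ex (sc (V a)) (let L = ↑ L ; k = ↑ k ; a = ↑ a ; xs = ↑ xs ; v = ↑ v ; f = ↑ f ; gs = zero in
         and (eq (V a) (pr (lit 4) (pr (V f) (V gs))))
         (ex (sc (V L)) (let L = ↑ L ; k = ↑ k ; xs = ↑ xs ; v = ↑ v ; f = ↑ f ; gs = ↑ gs ; ys = zero in
           and (ex (V k) (let L = ↑ L ; xs = ↑ xs ; gs = ↑ gs ; ys = ↑ ys ; j = zero in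
                  NodeAt (V L) (V j) (nodeTm 1 (V gs) (V xs) (V ys))))
               (ex (V k) (let L = ↑ L ; v = ↑ v ; f = ↑ f ; ys = ↑ ys ; j = zero in
                  NodeAt (V L) (V j) (nodeTm 0 (V f) (V ys) (V v))))))))
    RR = ex (sc (V a)) (let L = ↑ L ; k = ↑ k ; a = ↑ a ; xs = ↑ xs ; v = ↑ v ; f = zero in
         ex (sc (V a)) (let L = ↑ L ; k = ↑ k ; a = ↑ a ; xs = ↑ xs ; v = ↑ v ; f = ↑ f ; g = zero in
         and (eq (V a) (pr (lit 5) (pr (V f) (V g))))
          (or (and (eq (V xs) (consTm (lit 0) (tailTm′ (V xs))))
                   (and (ex (V k) (let L = ↑ L ; xs = ↑ xs ; v = ↑ v ; f = ↑ f ; j = zero in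
                           NodeAt (V L) (V j) (nodeTm 0 (V f) (tailTm′ (V xs)) (V v))))
                        (ex (V k) (let L = ↑ L ; g = ↑ g ; j = zero in
                           NodeAt (V L) (V j) (nodeTm 2 (V g) (lit 0) (lit 0))))))
              (ex (sc (V xs)) (let L = ↑ L ; k = ↑ k ; a = ↑ a ; xs = ↑ xs ; v = ↑ v ; g = ↑ g ; n = zero in
                 and (eq (V xs) (consTm (sc (V n)) (tailTm′ (V xs))))
                  (ex (sc (V L)) (let L = ↑ L ; k = ↑ k ; a = ↑ a ; xs = ↑ xs ; v = ↑ v ; g = ↑ g ; n = ↑ n ; w = zero in
                     and (ex (V k) (let L = ↑ L ; a = ↑ a ; xs = ↑ xs ; n = ↑ n ; w = ↑ w ; j = zero in
                            NodeAt (V L) (V j) (nodeTm 0 (V a) (consTm (V n) (tailTm′ (V xs))) (V w))))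
                         (ex (V k) (let L = ↑ L ; xs = ↑ xs ; v = ↑ v ; g = ↑ g ; n = ↑ n ; w = ↑ w ; j = zero in
                            NodeAt (V L) (V j) (nodeTm 0 (V g) (consTm (V n) (consTm (V w) (tailTm′ (V xs)))) (V v)))))))))))
    MR = ex (sc (V a)) (let L = ↑ L ; k = ↑ k ; a = ↑ a ; xs = ↑ xs ; v = ↑ v ; f = zero in
         and (eq (V a) (pr (lit 6) (V f)))
          (and (ex (V k) (let L = ↑ L ; xs = ↑ xs ; v = ↑ v ; f = ↑ f ; j = zero in
                  NodeAt (V L) (V j) (nodeTm 0 (V f) (consTm (V v) (V xs)) (lit 0))))
               (all (V v) (let L = ↑ L ; k = ↑ k ; xs = ↑ xs ; f = ↑ f ; z = zero in
                  ex (sc (V L)) (let L = ↑ L ; k = ↑ k ; xs = ↑ xs ; f = ↑ f ; z = ↑ z ; w = zero in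
                   ex (V k) (let L = ↑ L ; xs = ↑ xs ; f = ↑ f ; z = ↑ z ; w = ↑ w ; j = zero in
                    NodeAt (V L) (V j) (nodeTm 0 (V f) (consTm (V z) (V xs)) (sc (V w)))))))))

  EvalListRule : ∀ {m} → (L k a xs ys : Fin m) → Fm m
  EvalListRule L k a xs ys = or (and (eq (V a) (lit 0)) (eq (V ys) (lit 0)))
    (ex (sc (V a)) (let L = ↑ L ; k = ↑ k ; a = ↑ a ; xs = ↑ xs ; ys = ↑ ys ; g = zero in
     ex (sc (V a)) (let L = ↑ L ; k = ↑ k ; a = ↑ a ; xs = ↑ xs ; ys = ↑ ys ; g = ↑ g ; gs = zero in
     and (eq (V a) (consTm (V g) (V gs)))
      (ex (sc (V ys)) (let L = ↑ L ; k = ↑ k ; xs = ↑ xs ; ys = ↑ ys ; g = ↑ g ; gs = ↑ gs ; y = zero in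
        and (eq (V ys) (consTm (V y) (tailTm′ (V ys))))
         (and (ex (V k) (let L = ↑ L ; xs = ↑ xs ; g = ↑ g ; y = ↑ y ; j = zero in
                 NodeAt (V L) (V j) (nodeTm 0 (V g) (V xs) (V y))))
              (ex (V k) (let L = ↑ L ; xs = ↑ xs ; ys = ↑ ys ; gs = ↑ gs ; j = zero in
                 NodeAt (V L) (V j) (nodeTm 1 (V gs) (V xs) (tailTm′ (V ys)))))))))))

  CodeNodeBefore : ∀ {m} → (L k : Fin m) → ℕ → Fin m → Fm m
  CodeNodeBefore L k t f = ex (V k) (let L = ↑ L ; f = ↑ f ; j = zero in NodeAt (V L) (V j) (nodeTm t (V f) (lit 0) (lit 0)))

  CodeRule : ∀ {m} → (L k a : Fin m) → Fm m
  CodeRule L k a = or (eq (V a) (lit ⟪ 0 , 0 ⟫)) (or (eq (V a) (lit ⟪ 1 , 0 ⟫)) (or (eq (V a) (lit ⟪ 3 , 0 ⟫))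
    (or (ex (sc (V a)) (let a = ↑ a ; i = zero in eq (V a) (pr (lit 2) (V i))))
    (or (ex (sc (V a)) (let L = ↑ L ; k = ↑ k ; a = ↑ a ; f = zero in
         ex (sc (V a)) (let L = ↑ L ; k = ↑ k ; a = ↑ a ; f = ↑ f ; gs = zero in
          and (eq (V a) (pr (lit 4) (pr (V f) (V gs)))) (and (CodeNodeBefore L k 2 f) (CodeNodeBefore L k 3 gs)))))
    (or (ex (sc (V a)) (let L = ↑ L ; k = ↑ k ; a = ↑ a ; f = zero in
         ex (sc (V a)) (let L = ↑ L ; k = ↑ k ; a = ↑ a ; f = ↑ f ; g = zero in
          and (eq (V a) (pr (lit 5) (pr (V f) (V g)))) (and (CodeNodeBefore L k 2 f) (CodeNodeBefore L k 2 g)))))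
        (ex (sc (V a)) (let L = ↑ L ; k = ↑ k ; a = ↑ a ; f = zero in
          and (eq (V a) (pr (lit 6) (V f))) (CodeNodeBefore L k 2 f))))))))

  CodeListRule : ∀ {m} → (L k a : Fin m) → Fm m
  CodeListRule L k a = or (eq (V a) (lit 0))
    (ex (sc (V a)) (let L = ↑ L ; k = ↑ k ; a = ↑ a ; g = zero in
     ex (sc (V a)) (let L = ↑ L ; k = ↑ k ; a = ↑ a ; g = ↑ g ; gs = zero in
      and (eq (V a) (consTm (V g) (V gs))) (and (CodeNodeBefore L k 2 g) (CodeNodeBefore L k 3 gs)))))

  ValidNode : ∀ {m} → (L k : Fin m) → Fm m
  ValidNode L k = ex (sc (V L)) (let L = ↑ L ; k = ↑ k ; a = zero in
              ex (sc (V L)) (let L = ↑ L ; k = ↑ k ; a = ↑ a ; xs = zero in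
              ex (sc (V L)) (let L = ↑ L ; k = ↑ k ; a = ↑ a ; xs = ↑ xs ; v = zero in
     or (and (NodeAt (V L) (V k) (nodeTm 0 (V a) (V xs) (V v))) (EvalRule L k a xs v))
    (or (and (NodeAt (V L) (V k) (nodeTm 1 (V a) (V xs) (V v))) (EvalListRule L k a xs v))
    (or (and (NodeAt (V L) (V k) (nodeTm 2 (V a) (lit 0) (lit 0))) (CodeRule L k a))
        (and (NodeAt (V L) (V k) (nodeTm 3 (V a) (lit 0) (lit 0))) (CodeListRule L k a)))))))

  -- The certificate t is itself the code of the log, so one number bounds all witnesses.
  Certificate : ∀ {m} → (t n e : Fin m) → Fm m
  Certificate t n e = ex (sc (V t)) (let t = ↑ t ; n = ↑ n ; e = ↑ e ; N = zero in
     and (all (V N) (let t = ↑ t ; k = zero in ValidNode t k))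
         (ex (V N) (let t = ↑ t ; n = ↑ n ; e = ↑ e ; k = zero in
           ex (sc (V t)) (let t = ↑ t ; n = ↑ n ; e = ↑ e ; k = ↑ k ; v = zero in
             NodeAt (V t) (V k) (nodeTm 0 (V e) (consTm (V n) (lit 0)) (V v))))))

  Certificate₀ : Fm 3
  Certificate₀ = Certificate zero (suc zero) (suc (suc zero))



module LogSoundness where

  open Numbering
  open PrimitiveRecursion
  open BoundedFormulas
  open ListCoding
  open ComputationLogs
  open import Data.Nat
  open import Data.Nat.Properties
  open import Data.Vec using (Vec; []; _∷_; lookup)
  open import Data.Fin using (Fin; zero; suc)
  open import Data.List using (List; []; _∷_; drop)
  open import Data.Product using (Σ; _×_; _,_; proj₁; proj₂)
  open import Data.Sum using (inj₁; inj₂)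
  open import Relation.Nullary using (contradiction)
  open import Relation.Binary.PropositionalEquality

  NodeIs-unique : ∀ α L k t a b c t' a' b' c' → NodeIs α L k (nodeCode t a b c) → NodeIs α L k (nodeCode t' a' b' c') →
          t ≡ t' × a ≡ a' × b ≡ b' × c ≡ c'
  NodeIs-unique α L k t a b c t' a' b' c' n1 n2 =
    let e0 = proj₁ (⟪⟫-injective (nodeCode t a b c) (tailCode α (dropCode α L k)) (nodeCode t' a' b' c') (tailCode α (dropCode α L k)) (suc-injective (trans (sym n1) n2)))
        (e1 , r1) = ⟪⟫-injective t ⟪ a , ⟪ b , c ⟫ ⟫ t' ⟪ a' , ⟪ b' , c' ⟫ ⟫ e0
        (e2 , r2) = ⟪⟫-injective a ⟪ b , c ⟫ a' ⟪ b' , c' ⟫ r1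
        (e3 , e4) = ⟪⟫-injective b c b' c' r2
    in e1 , e2 , e3 , e4

  encodeList≡cons : ∀ l x r → encodeList l ≡ suc ⟪ x , r ⟫ → Σ (List ℕ) λ l' → l ≡ x ∷ l' × encodeList l' ≡ r
  encodeList≡cons [] x r ()
  encodeList≡cons (x' ∷ l) x r e with ⟪⟫-injective x' (encodeList l) x r (suc-injective e)
  ... | refl , e2 = l , refl , e2

  drop-nth : ∀ i l v l'' → drop i l ≡ v ∷ l'' → Nth i l v
  drop-nth zero (x ∷ l) v l'' refl = here
  drop-nth (suc i) (x ∷ l) v l'' e = there (drop-nth i l v l'' e)
  drop-nth zero [] v l'' ()
  drop-nth (suc i) [] v l'' ()

  record SoundNode (α : Baire) (L k : ℕ) : Set where
    field
      eval-sound : ∀ a xs v → NodeIs α L k (nodeCode 0 a xs v) → ∀ l → encodeList l ≡ xs →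
           Σ Code λ c → ⌜ c ⌝c ≡ a × Eval (π₂ (π₂ α)) c l v
      evalList-sound : ∀ a xs ys → NodeIs α L k (nodeCode 1 a xs ys) → ∀ l → encodeList l ≡ xs →
           Σ (List Code) λ gs → Σ (List ℕ) λ ys' → ⌜ gs ⌝cs ≡ a × encodeList ys' ≡ ys × EvalList (π₂ (π₂ α)) gs l ys'
      code-sound : ∀ a → NodeIs α L k (nodeCode 2 a 0 0) → Σ Code λ c → ⌜ c ⌝c ≡ a
      codeList-sound : ∀ a → NodeIs α L k (nodeCode 3 a 0 0) → Σ (List Code) λ gs → ⌜ gs ⌝cs ≡ a
  open SoundNode

  module Soundness {m} (α : Baire) (Li : Fin m) (ctx : Vec ℕ m) (k : ℕ)
              (IH : ∀ j → j < k → SoundNode α (lookup ctx Li) j) where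
    L = lookup ctx Li
    p = π₂ (π₂ α)

    VT : ℕ → ℕ → ℕ → Vec ℕ (suc (suc (suc (suc m))))
    VT a xs v = v ∷ xs ∷ a ∷ k ∷ ctx

    caseE : ∀ a xs v → Sat (EvalRule (suc (suc (suc (suc Li)))) (suc (suc (suc zero))) (suc (suc zero)) (suc zero) zero) α (VT a xs v) →
            ∀ a₁ xs₁ v₁ → 0 ≡ 0 × a ≡ a₁ × xs ≡ xs₁ × v ≡ v₁ → ∀ l → encodeList l ≡ xs₁ →
            Σ Code λ c → ⌜ c ⌝c ≡ a₁ × Eval p c l v₁
    caseE a xs v er .a .xs .v (_ , refl , refl , refl) l el = rule er
      where
      rule : Sat (EvalRule (suc (suc (suc (suc Li)))) (suc (suc (suc zero))) (suc (suc zero)) (suc zero) zero) α (v ∷ xs ∷ a ∷ k ∷ ctx) →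
             Σ Code λ c → ⌜ c ⌝c ≡ a × Eval p c l v
      rule (inj₁ (ea , ev)) = Zc , sym ea , subst (Eval p Zc l) (sym ev) ev-Z
      rule (inj₂ (inj₁ (ea , x , _ , exs , ev))) with encodeList≡cons l x (tailCode α xs) (trans el exs)
      ... | l' , refl , _ = Sc , sym ea , subst (Eval p Sc (x ∷ l')) (sym ev) ev-S
      rule (inj₂ (inj₂ (inj₁ (i , _ , ea , ed)))) with encodeList≡cons (drop i l) v (tailCode α (dropCode α xs i)) (trans (sym (dropCode-encodeList α i l)) (trans (cong (λ z → dropCode α z i) el) ed))
      ... | l'' , e , _ = Pc i , sym ea , ev-P (drop-nth i l v l'' e)
      rule (inj₂ (inj₂ (inj₂ (inj₁ (ea , x , _ , exs , ev))))) with encodeList≡cons l x (tailCode α xs) (trans el exs)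
      ... | l' , refl , _ = Oc , sym ea , subst (Eval p Oc (x ∷ l')) (sym ev) ev-O
      rule (inj₂ (inj₂ (inj₂ (inj₂ (inj₁ (f , _ , gs , _ , ea , ys , _ , (j1 , l1 , in1) , (j2 , l2 , in2))))))) =
        let (gs' , ys' , egs , eys , evl) = evalList-sound (IH j1 l1) gs xs ys in1 l el
            (f' , ef , evf) = eval-sound (IH j2 l2) f ys v in2 ys' eys
        in Cc f' gs' , trans (cong₂ (λ u w → ⟪ 4 , ⟪ u , w ⟫ ⟫) ef egs) (sym ea) , ev-C evl evf
      rule (inj₂ (inj₂ (inj₂ (inj₂ (inj₂ (inj₁ (f , _ , g , _ , ea , inj₁ (exs , (j1 , l1 , in1) , (j2 , l2 , in2))))))))) with encodeList≡cons l 0 (tailCode α xs) (trans el exs)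
      ... | l' , refl , el' =
        let (f' , ef , evf) = eval-sound (IH j1 l1) f (tailCode α xs) v in1 l' el'
            (g' , eg) = code-sound (IH j2 l2) g in2
        in Rc f' g' , trans (cong₂ (λ u w → ⟪ 5 , ⟪ u , w ⟫ ⟫) ef eg) (sym ea) , ev-R0 evf
      rule (inj₂ (inj₂ (inj₂ (inj₂ (inj₂ (inj₁ (f , _ , g , _ , ea , inj₂ (n , _ , exs , w , _ , (j1 , l1 , in1) , (j2 , l2 , in2))))))))) with encodeList≡cons l (suc n) (tailCode α xs) (trans el exs)
      ... | l' , refl , el' =
        let (c₁ , ec₁ , evc₁) = eval-sound (IH j1 l1) a (suc ⟪ n , tailCode α xs ⟫) w in1 (n ∷ l') (cong (λ z → suc ⟪ n , z ⟫) el')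
            (g' , eg' , evg) = eval-sound (IH j2 l2) g (suc ⟪ n , suc ⟪ w , tailCode α xs ⟫ ⟫) v in2 (n ∷ w ∷ l') (cong (λ z → suc ⟪ n , suc ⟪ w , z ⟫ ⟫) el')
            split = ⟪⟫-injective (tag c₁) (body c₁) 5 ⟪ f , g ⟫ (trans (sym (⌜⌝c≡⟪tag,body⟫ c₁)) (trans ec₁ ea))
            (f₁ , g₁ , ec) = tag≡5⇒Rc c₁ (proj₁ split)
        in c₁ , ec₁ , fin c₁ f₁ g₁ ec (proj₂ split) evc₁ g' eg' evg
        where
        fin : ∀ c₁ f₁ g₁ → c₁ ≡ Rc f₁ g₁ → body c₁ ≡ ⟪ f , g ⟫ → Eval p c₁ (n ∷ l') w →
              ∀ g' → ⌜ g' ⌝c ≡ g → Eval p g' (n ∷ w ∷ l') v → Eval p c₁ (suc n ∷ l') v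
        fin .(Rc f₁ g₁) f₁ g₁ refl eb e1 g' eg' e2 with ⌜⌝c-injective g₁ g' (trans (proj₂ (⟪⟫-injective ⌜ f₁ ⌝c ⌜ g₁ ⌝c f g eb)) (sym eg'))
        ... | refl = ev-RS e1 e2
      rule (inj₂ (inj₂ (inj₂ (inj₂ (inj₂ (inj₂ (f , _ , ea , (j1 , l1 , in1) , hz))))))) =
        let (f₀ , ef₀ , ev₀) = eval-sound (IH j1 l1) f (suc ⟪ v , xs ⟫) 0 in1 (v ∷ l) (cong (λ z → suc ⟪ v , z ⟫) el)
        in Mc f₀ , trans (cong (λ u → ⟪ 6 , u ⟫) ef₀) (sym ea) , ev-M ev₀ (λ z lz →
           let (w , _ , j , lj , inz) = hz z lz
               (f' , ef' , evz) = eval-sound (IH j lj) f (suc ⟪ z , xs ⟫) (suc w) inz (z ∷ l) (cong (λ u → suc ⟪ z , u ⟫) el)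
           in w , subst (λ c → Eval p c (z ∷ l) (suc w)) (⌜⌝c-injective f' f₀ (trans ef' (sym ef₀))) evz)

    partE : Sat (ValidNode (suc Li) zero) α (k ∷ ctx) → ∀ a xs v → NodeIs α L k (nodeCode 0 a xs v) → ∀ l → encodeList l ≡ xs →
            Σ Code λ c → ⌜ c ⌝c ≡ a × Eval p c l v
    partE (a , _ , xs , _ , v , _ , inj₁ (inN , er)) a₁ xs₁ v₁ nd l el = caseE a xs v er a₁ xs₁ v₁ (NodeIs-unique α L k 0 a xs v 0 a₁ xs₁ v₁ inN nd) l el
    partE (a , _ , xs , _ , v , _ , inj₂ (inj₁ (inN , _))) a₁ xs₁ v₁ nd l el = contradiction (proj₁ (NodeIs-unique α L k 1 a xs v 0 a₁ xs₁ v₁ inN nd)) λ ()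
    partE (a , _ , xs , _ , v , _ , inj₂ (inj₂ (inj₁ (inN , _)))) a₁ xs₁ v₁ nd l el = contradiction (proj₁ (NodeIs-unique α L k 2 a 0 0 0 a₁ xs₁ v₁ inN nd)) λ ()
    partE (a , _ , xs , _ , v , _ , inj₂ (inj₂ (inj₂ (inN , _)))) a₁ xs₁ v₁ nd l el = contradiction (proj₁ (NodeIs-unique α L k 3 a 0 0 0 a₁ xs₁ v₁ inN nd)) λ ()


    caseL : ∀ a xs v → Sat (EvalListRule (suc (suc (suc (suc Li)))) (suc (suc (suc zero))) (suc (suc zero)) (suc zero) zero) α (VT a xs v) →
            ∀ l → encodeList l ≡ xs →
            Σ (List Code) λ gs → Σ (List ℕ) λ ys' → ⌜ gs ⌝cs ≡ a × encodeList ys' ≡ v × EvalList p gs l ys'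
    caseL a xs v (inj₁ (ea , eys)) l el = [] , [] , sym ea , sym eys , evl-[]
    caseL a xs v (inj₂ (g , _ , gs , _ , ea , y , _ , eys , (j1 , l1 , in1) , (j2 , l2 , in2))) l el =
        let (g' , eg , evg) = eval-sound (IH j1 l1) g xs y in1 l el
            (gs' , ys' , egs , eys' , evl) = evalList-sound (IH j2 l2) gs xs (tailCode α v) in2 l el
        in g' ∷ gs' , y ∷ ys' , trans (cong₂ (λ u w → suc ⟪ u , w ⟫) eg egs) (sym ea) ,
           trans (cong (λ z → suc ⟪ y , z ⟫) eys') (sym eys) , evl-∷ evg evl

    partL : Sat (ValidNode (suc Li) zero) α (k ∷ ctx) → ∀ a xs ys → NodeIs α L k (nodeCode 1 a xs ys) → ∀ l → encodeList l ≡ xs →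
           Σ (List Code) λ gs → Σ (List ℕ) λ ys' → ⌜ gs ⌝cs ≡ a × encodeList ys' ≡ ys × EvalList p gs l ys'
    partL (a , _ , xs , _ , v , _ , inj₂ (inj₁ (inN , lr))) a₁ xs₁ v₁ nd l el with NodeIs-unique α L k 1 a xs v 1 a₁ xs₁ v₁ inN nd
    ... | _ , refl , refl , refl = caseL a xs v lr l el
    partL (a , _ , xs , _ , v , _ , inj₁ (inN , _)) a₁ xs₁ v₁ nd l el = contradiction (proj₁ (NodeIs-unique α L k 0 a xs v 1 a₁ xs₁ v₁ inN nd)) λ ()
    partL (a , _ , xs , _ , v , _ , inj₂ (inj₂ (inj₁ (inN , _)))) a₁ xs₁ v₁ nd l el = contradiction (proj₁ (NodeIs-unique α L k 2 a 0 0 1 a₁ xs₁ v₁ inN nd)) λ ()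
    partL (a , _ , xs , _ , v , _ , inj₂ (inj₂ (inj₂ (inN , _)))) a₁ xs₁ v₁ nd l el = contradiction (proj₁ (NodeIs-unique α L k 3 a 0 0 1 a₁ xs₁ v₁ inN nd)) λ ()

    partC : Sat (ValidNode (suc Li) zero) α (k ∷ ctx) → ∀ a → NodeIs α L k (nodeCode 2 a 0 0) → Σ Code λ c → ⌜ c ⌝c ≡ a
    partC (a , _ , xs , _ , v , _ , inj₂ (inj₂ (inj₁ (inN , cr)))) a₁ nd with NodeIs-unique α L k 2 a 0 0 2 a₁ 0 0 inN nd
    ... | _ , refl , _ , _ = caseC' a xs v cr
      where
      caseC' : ∀ a xs v → Sat (CodeRule (suc (suc (suc (suc Li)))) (suc (suc (suc zero))) (suc (suc zero))) α (VT a xs v) →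
               Σ Code λ c → ⌜ c ⌝c ≡ a
      caseC' a xs v (inj₁ ea) = Zc , sym ea
      caseC' a xs v (inj₂ (inj₁ ea)) = Sc , sym ea
      caseC' a xs v (inj₂ (inj₂ (inj₁ ea))) = Oc , sym ea
      caseC' a xs v (inj₂ (inj₂ (inj₂ (inj₁ (i , _ , ea))))) = Pc i , sym ea
      caseC' a xs v (inj₂ (inj₂ (inj₂ (inj₂ (inj₁ (f , _ , gs , _ , ea , (j1 , l1 , in1) , (j2 , l2 , in2))))))) =
        let (f' , ef) = code-sound (IH j1 l1) f in1
            (gs' , egs) = codeList-sound (IH j2 l2) gs in2
        in Cc f' gs' , trans (cong₂ (λ u w → ⟪ 4 , ⟪ u , w ⟫ ⟫) ef egs) (sym ea)
      caseC' a xs v (inj₂ (inj₂ (inj₂ (inj₂ (inj₂ (inj₁ (f , _ , g , _ , ea , (j1 , l1 , in1) , (j2 , l2 , in2)))))))) =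
        let (f' , ef) = code-sound (IH j1 l1) f in1
            (g' , eg) = code-sound (IH j2 l2) g in2
        in Rc f' g' , trans (cong₂ (λ u w → ⟪ 5 , ⟪ u , w ⟫ ⟫) ef eg) (sym ea)
      caseC' a xs v (inj₂ (inj₂ (inj₂ (inj₂ (inj₂ (inj₂ (f , _ , ea , (j1 , l1 , in1)))))))) =
        let (f' , ef) = code-sound (IH j1 l1) f in1
        in Mc f' , trans (cong (λ u → ⟪ 6 , u ⟫) ef) (sym ea)
    partC (a , _ , xs , _ , v , _ , inj₁ (inN , _)) a₁ nd = contradiction (proj₁ (NodeIs-unique α L k 0 a xs v 2 a₁ 0 0 inN nd)) λ ()
    partC (a , _ , xs , _ , v , _ , inj₂ (inj₁ (inN , _))) a₁ nd = contradiction (proj₁ (NodeIs-unique α L k 1 a xs v 2 a₁ 0 0 inN nd)) λ ()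
    partC (a , _ , xs , _ , v , _ , inj₂ (inj₂ (inj₂ (inN , _)))) a₁ nd = contradiction (proj₁ (NodeIs-unique α L k 3 a 0 0 2 a₁ 0 0 inN nd)) λ ()

    partCL : Sat (ValidNode (suc Li) zero) α (k ∷ ctx) → ∀ a → NodeIs α L k (nodeCode 3 a 0 0) → Σ (List Code) λ gs → ⌜ gs ⌝cs ≡ a
    partCL (a , _ , xs , _ , v , _ , inj₂ (inj₂ (inj₂ (inN , cr)))) a₁ nd with NodeIs-unique α L k 3 a 0 0 3 a₁ 0 0 inN nd
    ... | _ , refl , _ , _ = caseCL a xs v cr
      where
      caseCL : ∀ a xs v → Sat (CodeListRule (suc (suc (suc (suc Li)))) (suc (suc (suc zero))) (suc (suc zero))) α (VT a xs v) →
               Σ (List Code) λ gs → ⌜ gs ⌝cs ≡ a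
      caseCL a xs v (inj₁ ea) = [] , sym ea
      caseCL a xs v (inj₂ (g , _ , gs , _ , ea , (j1 , l1 , in1) , (j2 , l2 , in2))) =
        let (g' , eg) = code-sound (IH j1 l1) g in1
            (gs' , egs) = codeList-sound (IH j2 l2) gs in2
        in g' ∷ gs' , trans (cong₂ (λ u w → suc ⟪ u , w ⟫) eg egs) (sym ea)
    partCL (a , _ , xs , _ , v , _ , inj₁ (inN , _)) a₁ nd = contradiction (proj₁ (NodeIs-unique α L k 0 a xs v 3 a₁ 0 0 inN nd)) λ ()
    partCL (a , _ , xs , _ , v , _ , inj₂ (inj₁ (inN , _))) a₁ nd = contradiction (proj₁ (NodeIs-unique α L k 1 a xs v 3 a₁ 0 0 inN nd)) λ ()
    partCL (a , _ , xs , _ , v , _ , inj₂ (inj₂ (inj₁ (inN , _)))) a₁ nd = contradiction (proj₁ (NodeIs-unique α L k 2 a 0 0 3 a₁ 0 0 inN nd)) λ ()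

    node-sound : Sat (ValidNode (suc Li) zero) α (k ∷ ctx) → SoundNode α L k
    node-sound sat = record { eval-sound = partE sat ; evalList-sound = partL sat ; code-sound = partC sat ; codeList-sound = partCL sat }

  -- Strong induction on the position: a valid node refers only to earlier nodes.
  valid⇒sound : ∀ {m} α (Li : Fin m) ctx N → (∀ k → k < N → Sat (ValidNode (suc Li) zero) α (k ∷ ctx)) →
          ∀ k → k < N → SoundNode α (lookup ctx Li) k
  valid⇒sound α Li ctx N H k lt = below N k lt ≤-refl
    where
    below : ∀ K k → k < K → K ≤ N → SoundNode α (lookup ctx Li) k
    below (suc K) k (s≤s k≤K) le =
      Soundness.node-sound α Li ctx k (λ j lj → below K j (<-≤-trans lj k≤K) (≤-trans (n≤1+n K) le)) (H k (<-≤-trans (s≤s k≤K) le))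


module Derivations where

  open Numbering
  open ListCoding
  open ComputationLogs using (nodeCode)
  open import Data.Nat
  open import Data.Nat.Properties
  open import Data.List using (List; []; _∷_; _++_; drop; take; [_])
  open import Data.List.Properties using (++-assoc; ++-identityʳ)
  open import Data.List.Membership.Propositional using (_∈_)
  open import Data.List.Membership.Propositional.Properties using (∈-++⁺ˡ; ∈-++⁺ʳ)
  open import Data.List.Relation.Unary.Any using (here)
  open import Data.Product using (Σ; _×_; _,_; proj₁; proj₂)
  open import Data.Empty using (⊥-elim)
  open import Data.Sum using (inj₁; inj₂)
  open import Relation.Binary.PropositionalEquality hiding ([_])

  data Rule (α : Baire) (P : ℕ → Set) : ℕ → Set where
    jZ : ∀ l → Rule α P (nodeCode 0 ⌜ Zc ⌝c (encodeList l) 0)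
    jS : ∀ x l → Rule α P (nodeCode 0 ⌜ Sc ⌝c (encodeList (x ∷ l)) (suc x))
    jP : ∀ i l v → Nth i l v → Rule α P (nodeCode 0 ⌜ Pc i ⌝c (encodeList l) v)
    jO : ∀ x l → Rule α P (nodeCode 0 ⌜ Oc ⌝c (encodeList (x ∷ l)) (π₂ (π₂ α) x))
    jC : ∀ f gs l ys v → P (nodeCode 1 ⌜ gs ⌝cs (encodeList l) (encodeList ys)) → P (nodeCode 0 ⌜ f ⌝c (encodeList ys) v) →
         Rule α P (nodeCode 0 ⌜ Cc f gs ⌝c (encodeList l) v)
    jR0 : ∀ f g l v → P (nodeCode 0 ⌜ f ⌝c (encodeList l) v) → P (nodeCode 2 ⌜ g ⌝c 0 0) →
          Rule α P (nodeCode 0 ⌜ Rc f g ⌝c (encodeList (0 ∷ l)) v)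
    jRS : ∀ f g n l w v → P (nodeCode 0 ⌜ Rc f g ⌝c (encodeList (n ∷ l)) w) → P (nodeCode 0 ⌜ g ⌝c (encodeList (n ∷ w ∷ l)) v) →
          Rule α P (nodeCode 0 ⌜ Rc f g ⌝c (encodeList (suc n ∷ l)) v)
    jM : ∀ f l y → P (nodeCode 0 ⌜ f ⌝c (encodeList (y ∷ l)) 0) → (∀ z → z < y → Σ ℕ λ w → P (nodeCode 0 ⌜ f ⌝c (encodeList (z ∷ l)) (suc w))) →
         Rule α P (nodeCode 0 ⌜ Mc f ⌝c (encodeList l) y)
    jLn : ∀ l → Rule α P (nodeCode 1 0 (encodeList l) 0)
    jLc : ∀ g gs l y ys → P (nodeCode 0 ⌜ g ⌝c (encodeList l) y) → P (nodeCode 1 ⌜ gs ⌝cs (encodeList l) (encodeList ys)) →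
          Rule α P (nodeCode 1 ⌜ g ∷ gs ⌝cs (encodeList l) (encodeList (y ∷ ys)))
    jKZ : Rule α P (nodeCode 2 ⌜ Zc ⌝c 0 0)
    jKS : Rule α P (nodeCode 2 ⌜ Sc ⌝c 0 0)
    jKP : ∀ i → Rule α P (nodeCode 2 ⌜ Pc i ⌝c 0 0)
    jKO : Rule α P (nodeCode 2 ⌜ Oc ⌝c 0 0)
    jKC : ∀ f gs → P (nodeCode 2 ⌜ f ⌝c 0 0) → P (nodeCode 3 ⌜ gs ⌝cs 0 0) → Rule α P (nodeCode 2 ⌜ Cc f gs ⌝c 0 0)
    jKR : ∀ f g → P (nodeCode 2 ⌜ f ⌝c 0 0) → P (nodeCode 2 ⌜ g ⌝c 0 0) → Rule α P (nodeCode 2 ⌜ Rc f g ⌝c 0 0)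
    jKM : ∀ f → P (nodeCode 2 ⌜ f ⌝c 0 0) → Rule α P (nodeCode 2 ⌜ Mc f ⌝c 0 0)
    jKn : Rule α P (nodeCode 3 0 0 0)
    jKc : ∀ g gs → P (nodeCode 2 ⌜ g ⌝c 0 0) → P (nodeCode 3 ⌜ gs ⌝cs 0 0) → Rule α P (nodeCode 3 ⌜ g ∷ gs ⌝cs 0 0)

  Rule-map : ∀ {α P Q} → (∀ u → P u → Q u) → ∀ {u} → Rule α P u → Rule α Q u
  Rule-map h (jZ l) = jZ l
  Rule-map h (jS x l) = jS x l
  Rule-map h (jP i l v n) = jP i l v n
  Rule-map h (jO x l) = jO x l
  Rule-map h (jC f gs l ys v p1 p2) = jC f gs l ys v (h _ p1) (h _ p2)
  Rule-map h (jR0 f g l v p1 p2) = jR0 f g l v (h _ p1) (h _ p2)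
  Rule-map h (jRS f g n l w v p1 p2) = jRS f g n l w v (h _ p1) (h _ p2)
  Rule-map h (jM f l y p1 p2) = jM f l y (h _ p1) (λ z lz → proj₁ (p2 z lz) , h _ (proj₂ (p2 z lz)))
  Rule-map h (jLn l) = jLn l
  Rule-map h (jLc g gs l y ys p1 p2) = jLc g gs l y ys (h _ p1) (h _ p2)
  Rule-map h jKZ = jKZ
  Rule-map h jKS = jKS
  Rule-map h (jKP i) = jKP i
  Rule-map h jKO = jKO
  Rule-map h (jKC f gs p1 p2) = jKC f gs (h _ p1) (h _ p2)
  Rule-map h (jKR f g p1 p2) = jKR f g (h _ p1) (h _ p2)
  Rule-map h (jKM f p1) = jKM f (h _ p1)
  Rule-map h jKn = jKn
  Rule-map h (jKc g gs p1 p2) = jKc g gs (h _ p1) (h _ p2)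

  DerivedAfter : Baire → List ℕ → List ℕ → Set
  DerivedAfter α Pre Ls = ∀ k u r → drop k Ls ≡ u ∷ r → Rule α (λ u' → u' ∈ Pre ++ take k Ls) u

  ∈-subst : ∀ {A B : List ℕ} → A ≡ B → ∀ u → u ∈ A → u ∈ B
  ∈-subst refl u m = m

  derivedAfter-++ : ∀ α Pre A B → DerivedAfter α Pre A → DerivedAfter α (Pre ++ A) B → DerivedAfter α Pre (A ++ B)
  derivedAfter-++ α Pre [] B cA cB k u r e = Rule-map (∈-subst (cong (_++ take k B) (++-identityʳ Pre))) (cB k u r e)
  derivedAfter-++ α Pre (x ∷ A) B cA cB zero .x .(A ++ B) refl = cA zero x A refl
  derivedAfter-++ α Pre (x ∷ A) B cA cB (suc k) u r e =
    Rule-map (∈-subst (++-assoc Pre [ x ] (take k (A ++ B))))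
      (derivedAfter-++ α (Pre ++ [ x ]) A B cA' cB' k u r e)
    where
    cA' : DerivedAfter α (Pre ++ [ x ]) A
    cA' k' u' r' e' = Rule-map (∈-subst (sym (++-assoc Pre [ x ] (take k' A)))) (cA (suc k') u' r' e')
    cB' : DerivedAfter α ((Pre ++ [ x ]) ++ A) B
    cB' k' u' r' e' = Rule-map (∈-subst (cong (_++ take k' B) (sym (++-assoc Pre [ x ] A)))) (cB k' u' r' e')

  derivedAfter-weaken : ∀ α A B → DerivedAfter α [] B → DerivedAfter α A B
  derivedAfter-weaken α A B c k u r e = Rule-map (λ u' m → ∈-++⁺ʳ A m) (c k u r e)

  drop-[]≢∷ : ∀ k {u : ℕ} {r} → drop k [] ≢ u ∷ r
  drop-[]≢∷ zero ()
  drop-[]≢∷ (suc k) ()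

  derivedAfter-single : ∀ α Pre u → Rule α (λ u' → u' ∈ Pre) u → DerivedAfter α Pre [ u ]
  derivedAfter-single α Pre u j zero .u .[] refl = Rule-map (∈-subst (sym (++-identityʳ Pre))) j
  derivedAfter-single α Pre u j (suc k) u' r e = ⊥-elim (drop-[]≢∷ k e)

  Derived : Baire → List ℕ → Set
  Derived α Ls = DerivedAfter α [] Ls

  join : ∀ α A B → Derived α A → Derived α B → Derived α (A ++ B)
  join α A B cA cB = derivedAfter-++ α [] A B cA (derivedAfter-weaken α A B cB)

  snoc : ∀ α A u → Derived α A → Rule α (λ u' → u' ∈ A) u → Derived α (A ++ [ u ])
  snoc α A u cA j = derivedAfter-++ α [] A [ u ] cA (derivedAfter-single α A u j)

  single : ∀ α u → Rule α (λ u' → u' ∈ []) u → Derived α [ u ]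
  single α u j = derivedAfter-single α [] u j

  last∈ : ∀ (A : List ℕ) u → u ∈ A ++ [ u ]
  last∈ A u = ∈-++⁺ʳ A (here refl)

  mutual
    code-derived : ∀ α c → Σ (List ℕ) λ Ls → Derived α Ls × nodeCode 2 ⌜ c ⌝c 0 0 ∈ Ls
    code-derived α Zc = _ , single α _ jKZ , here refl
    code-derived α Sc = _ , single α _ jKS , here refl
    code-derived α (Pc i) = _ , single α _ (jKP i) , here refl
    code-derived α Oc = _ , single α _ jKO , here refl
    code-derived α (Cc f gs) =
      let (A , cA , mA) = code-derived α f
          (B , cB , mB) = codes-derived α gs
      in (A ++ B) ++ _ , snoc α (A ++ B) _ (join α A B cA cB) (jKC f gs (∈-++⁺ˡ mA) (∈-++⁺ʳ A mB)) , last∈ (A ++ B) _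
    code-derived α (Rc f g) =
      let (A , cA , mA) = code-derived α f
          (B , cB , mB) = code-derived α g
      in (A ++ B) ++ _ , snoc α (A ++ B) _ (join α A B cA cB) (jKR f g (∈-++⁺ˡ mA) (∈-++⁺ʳ A mB)) , last∈ (A ++ B) _
    code-derived α (Mc f) =
      let (A , cA , mA) = code-derived α f
      in A ++ _ , snoc α A _ cA (jKM f mA) , last∈ A _

    codes-derived : ∀ α gs → Σ (List ℕ) λ Ls → Derived α Ls × nodeCode 3 ⌜ gs ⌝cs 0 0 ∈ Ls
    codes-derived α [] = _ , single α _ jKn , here refl
    codes-derived α (g ∷ gs) =
      let (A , cA , mA) = code-derived α g
          (B , cB , mB) = codes-derived α gs
      in (A ++ B) ++ _ , snoc α (A ++ B) _ (join α A B cA cB) (jKc g gs (∈-++⁺ˡ mA) (∈-++⁺ʳ A mB)) , last∈ (A ++ B) _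

  mutual
    eval-derived : ∀ α {c l v} → Eval (π₂ (π₂ α)) c l v → Σ (List ℕ) λ Ls → Derived α Ls × nodeCode 0 ⌜ c ⌝c (encodeList l) v ∈ Ls
    eval-derived α {l = l} ev-Z = _ , single α _ (jZ l) , here refl
    eval-derived α (ev-S {x} {xs}) = _ , single α _ (jS x xs) , here refl
    eval-derived α (ev-P {i} {xs} {v} n) = _ , single α _ (jP i xs v n) , here refl
    eval-derived α (ev-O {x} {xs}) = _ , single α _ (jO x xs) , here refl
    eval-derived α (ev-C {f} {gs} {xs} {ys} {v} el e) =
      let (A , cA , mA) = evalList-derived α el
          (B , cB , mB) = eval-derived α e
      in (A ++ B) ++ _ , snoc α (A ++ B) _ (join α A B cA cB) (jC f gs xs ys v (∈-++⁺ˡ mA) (∈-++⁺ʳ A mB)) , last∈ (A ++ B) _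
    eval-derived α (ev-R0 {f} {g} {xs} {v} e) =
      let (A , cA , mA) = eval-derived α e
          (B , cB , mB) = code-derived α g
      in (A ++ B) ++ _ , snoc α (A ++ B) _ (join α A B cA cB) (jR0 f g xs v (∈-++⁺ˡ mA) (∈-++⁺ʳ A mB)) , last∈ (A ++ B) _
    eval-derived α (ev-RS {f} {g} {n} {xs} {w} {v} e1 e2) =
      let (A , cA , mA) = eval-derived α e1
          (B , cB , mB) = eval-derived α e2
      in (A ++ B) ++ _ , snoc α (A ++ B) _ (join α A B cA cB) (jRS f g n xs w v (∈-++⁺ˡ mA) (∈-++⁺ʳ A mB)) , last∈ (A ++ B) _
    eval-derived α (ev-M {f} {xs} {y} e0 h) =
      let (A , cA , mA) = eval-derived α e0
          (B , cB , mB) = search-derived α f xs y h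
      in (A ++ B) ++ _ , snoc α (A ++ B) _ (join α A B cA cB)
           (jM f xs y (∈-++⁺ˡ mA) (λ z lz → proj₁ (mB z lz) , ∈-++⁺ʳ A (proj₂ (mB z lz)))) , last∈ (A ++ B) _

    search-derived : ∀ α f xs y → (∀ z → z < y → Σ ℕ (λ w → Eval (π₂ (π₂ α)) f (z ∷ xs) (suc w))) →
            Σ (List ℕ) λ Ls → Derived α Ls × (∀ z → z < y → Σ ℕ λ w → nodeCode 0 ⌜ f ⌝c (encodeList (z ∷ xs)) (suc w) ∈ Ls)
    search-derived α f xs zero h = [] , (λ k u r e → ⊥-elim (drop-[]≢∷ k e)) , λ z ()
    search-derived α f xs (suc y) h =
      let (A , cA , mA) = search-derived α f xs y (λ z lz → h z (m≤n⇒m≤1+n lz))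
          (B , cB , mB) = eval-derived α (proj₂ (h y ≤-refl))
      in A ++ B , join α A B cA cB , λ z lz → pick z lz A B mA mB
      where
      pick : ∀ z → z < suc y → (A B : List ℕ) →
             (∀ z → z < y → Σ ℕ λ w → nodeCode 0 ⌜ f ⌝c (encodeList (z ∷ xs)) (suc w) ∈ A) →
             nodeCode 0 ⌜ f ⌝c (encodeList (y ∷ xs)) (suc (proj₁ (h y ≤-refl))) ∈ B →
             Σ ℕ λ w → nodeCode 0 ⌜ f ⌝c (encodeList (z ∷ xs)) (suc w) ∈ A ++ B
      pick z lz A B mA mB with m≤n⇒m<n∨m≡n (s≤s⁻¹ lz)
      ... | inj₁ l' = proj₁ (mA z l') , ∈-++⁺ˡ (proj₂ (mA z l'))
      ... | inj₂ refl = _ , ∈-++⁺ʳ A mB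

    evalList-derived : ∀ α {gs l ys} → EvalList (π₂ (π₂ α)) gs l ys → Σ (List ℕ) λ Ls → Derived α Ls × nodeCode 1 ⌜ gs ⌝cs (encodeList l) (encodeList ys) ∈ Ls
    evalList-derived α {l = l} evl-[] = _ , single α _ (jLn l) , here refl
    evalList-derived α (evl-∷ {g} {gs} {xs} {y} {ys} e el) =
      let (A , cA , mA) = eval-derived α e
          (B , cB , mB) = evalList-derived α el
      in (A ++ B) ++ _ , snoc α (A ++ B) _ (join α A B cA cB) (jLc g gs xs y ys (∈-++⁺ˡ mA) (∈-++⁺ʳ A mB)) , last∈ (A ++ B) _


module LogCompleteness where

  open Numbering
  open BoundedFormulas
  open ListCoding
  open ComputationLogs
  open Derivations
  open import Data.Nat
  open import Data.Nat.Properties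
  open import Data.Vec using (Vec; []; _∷_)
  open import Data.Fin using (Fin; zero; suc)
  open import Data.List using (List; []; _∷_; drop; take)
  open import Data.List.Membership.Propositional using (_∈_)
  open import Data.List.Relation.Unary.Any using (here; there)
  open import Data.Product using (Σ; _×_; _,_)
  open import Data.Sum using (inj₁; inj₂)
  open import Relation.Binary.PropositionalEquality hiding ([_])

  drop⇒NodeIs : ∀ α Ls j u r → drop j Ls ≡ u ∷ r → NodeIs α (encodeList Ls) j u
  drop⇒NodeIs α Ls j u r e rewrite dropCode-encodeList α j Ls | e = cong (λ z → suc ⟪ u , z ⟫) (sym (tailCode-cons α u (encodeList r)))

  ∈take : ∀ {u} k (Ls : List ℕ) → u ∈ take k Ls → Σ ℕ λ j → Σ (List ℕ) λ r → j < k × drop j Ls ≡ u ∷ r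
  ∈take (suc k) (x ∷ Ls) (here refl) = 0 , Ls , s≤s z≤n , refl
  ∈take (suc k) (x ∷ Ls) (there m) = let (j , r , l , e) = ∈take k Ls m in suc j , r , s≤s l , e

  nth-drop : ∀ {i l v} → Nth i l v → Σ (List ℕ) λ r → drop i l ≡ v ∷ r
  nth-drop (here {xs = xs}) = xs , refl
  nth-drop (there n) = nth-drop n

  lenc-drop≤ : ∀ j (Ls : List ℕ) → encodeList (drop j Ls) ≤ encodeList Ls
  lenc-drop≤ zero Ls = ≤-refl
  lenc-drop≤ (suc j) [] = ≤-refl
  lenc-drop≤ (suc j) (x ∷ Ls) = ≤-trans (lenc-drop≤ j Ls) (<⇒≤ (m<n⇒m<1+n (snd<⟪⟫ x (encodeList Ls))))

  drop⇒<encodeList : ∀ j (Ls : List ℕ) u r → drop j Ls ≡ u ∷ r → u < encodeList Ls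
  drop⇒<encodeList j Ls u r e = <-≤-trans (s≤s (<⇒≤ (fst<⟪⟫ u (encodeList r)))) (subst (λ z → encodeList z ≤ encodeList Ls) e (lenc-drop≤ j Ls))

  a≤nodeCode : ∀ t a b c → a ≤ nodeCode t a b c
  a≤nodeCode t a b c = ≤-trans (fst≤⟪⟫ a ⟪ b , c ⟫) (snd≤⟪⟫ t ⟪ a , ⟪ b , c ⟫ ⟫)
  b≤nodeCode : ∀ t a b c → b ≤ nodeCode t a b c
  b≤nodeCode t a b c = ≤-trans (fst≤⟪⟫ b c) (≤-trans (snd≤⟪⟫ a ⟪ b , c ⟫) (snd≤⟪⟫ t ⟪ a , ⟪ b , c ⟫ ⟫))
  c≤nodeCode : ∀ t a b c → c ≤ nodeCode t a b c
  c≤nodeCode t a b c = ≤-trans (snd≤⟪⟫ b c) (≤-trans (snd≤⟪⟫ a ⟪ b , c ⟫) (snd≤⟪⟫ t ⟪ a , ⟪ b , c ⟫ ⟫))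

  module Validity (α : Baire) (Ls : List ℕ) (k : ℕ) {m} (N : ℕ) (ctx : Vec ℕ m) where
    L = encodeList Ls

    prem : ∀ {u'} → u' ∈ take k Ls → Σ ℕ λ j → j < k × NodeIs α L j u'
    prem mm = let (j , r , l , e) = ∈take k Ls mm in j , l , drop⇒NodeIs α Ls j _ r e

    premB : ∀ {u'} → u' ∈ take k Ls → u' < L
    premB mm = let (j , r , l , e) = ∈take k Ls mm in drop⇒<encodeList j Ls _ r e

    derived⇒valid : ∀ u r → drop k Ls ≡ u ∷ r → Rule α (λ u' → u' ∈ take k Ls) u →
             Sat (ValidNode (suc (suc zero)) zero) α (k ∷ N ∷ L ∷ ctx)
    derived⇒valid u r e j = go j
      where
      inK = drop⇒NodeIs α Ls k u r e
      uL : u < L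
      uL = drop⇒<encodeList k Ls u r e
      bA : ∀ t a b c → u ≡ nodeCode t a b c → a < suc L
      bA t a b c refl = s≤s (≤-trans (a≤nodeCode t a b c) (<⇒≤ uL))
      bB : ∀ t a b c → u ≡ nodeCode t a b c → b < suc L
      bB t a b c refl = s≤s (≤-trans (b≤nodeCode t a b c) (<⇒≤ uL))
      bC : ∀ t a b c → u ≡ nodeCode t a b c → c < suc L
      bC t a b c refl = s≤s (≤-trans (c≤nodeCode t a b c) (<⇒≤ uL))
      z< : 0 < suc L
      z< = s≤s z≤n
      F0 : ∀ {n} → Fin (suc n)
      F0 = zero
      VC = λ (v xs a : ℕ) → v ∷ xs ∷ a ∷ k ∷ N ∷ L ∷ ctx
      mkE : ∀ a xs v → u ≡ nodeCode 0 a xs v →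
            Sat (EvalRule (suc (suc (suc (suc (suc zero))))) (suc (suc (suc zero))) (suc (suc zero)) (suc zero) zero) α (VC v xs a) →
            Sat (ValidNode (suc (suc zero)) zero) α (k ∷ N ∷ L ∷ ctx)
      mkE a xs v eu r = a , bA 0 a xs v eu , xs , bB 0 a xs v eu , v , bC 0 a xs v eu ,
                        inj₁ (subst (NodeIs α L k) eu inK , r)
      mkL : ∀ a xs v → u ≡ nodeCode 1 a xs v →
            Sat (EvalListRule (suc (suc (suc (suc (suc zero))))) (suc (suc (suc zero))) (suc (suc zero)) (suc zero) zero) α (VC v xs a) →
            Sat (ValidNode (suc (suc zero)) zero) α (k ∷ N ∷ L ∷ ctx)
      mkL a xs v eu r = a , bA 1 a xs v eu , xs , bB 1 a xs v eu , v , bC 1 a xs v eu ,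
                        inj₂ (inj₁ (subst (NodeIs α L k) eu inK , r))
      mkC : ∀ a → u ≡ nodeCode 2 a 0 0 →
            Sat (CodeRule (suc (suc (suc (suc (suc zero))))) (suc (suc (suc zero))) (suc (suc zero))) α (VC 0 0 a) →
            Sat (ValidNode (suc (suc zero)) zero) α (k ∷ N ∷ L ∷ ctx)
      mkC a eu r = a , bA 2 a 0 0 eu , 0 , z< , 0 , z< , inj₂ (inj₂ (inj₁ (subst (NodeIs α L k) eu inK , r)))
      mkCL : ∀ a → u ≡ nodeCode 3 a 0 0 →
            Sat (CodeListRule (suc (suc (suc (suc (suc zero))))) (suc (suc (suc zero))) (suc (suc zero))) α (VC 0 0 a) →
            Sat (ValidNode (suc (suc zero)) zero) α (k ∷ N ∷ L ∷ ctx)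
      mkCL a eu r = a , bA 3 a 0 0 eu , 0 , z< , 0 , z< , inj₂ (inj₂ (inj₂ (subst (NodeIs α L k) eu inK , r)))
      go : Rule α (λ u' → u' ∈ take k Ls) u → Sat (ValidNode (suc (suc zero)) zero) α (k ∷ N ∷ L ∷ ctx)
      go (jZ l) = mkE ⌜ Zc ⌝c (encodeList l) 0 refl (inj₁ (refl , refl))
      go (jS x l) = mkE ⌜ Sc ⌝c (encodeList (x ∷ l)) (suc x) refl
        (inj₂ (inj₁ (refl , x , s≤s (≤-trans (fst≤⟪⟫ x (encodeList l)) (n≤1+n _)) ,
          cong (λ z → suc ⟪ x , z ⟫) (sym (tailCode-cons α x (encodeList l))) , refl)))
      go (jP i l v n) = mkE ⌜ Pc i ⌝c (encodeList l) v refl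
        (inj₂ (inj₂ (inj₁ (i , s≤s (snd≤⟪⟫ 2 i) , refl ,
          let (r' , e') = nth-drop n in drop⇒NodeIs α l i v r' e'))))
      go (jO x l) = mkE ⌜ Oc ⌝c (encodeList (x ∷ l)) (π₂ (π₂ α) x) refl
        (inj₂ (inj₂ (inj₂ (inj₁ (refl , x , s≤s (≤-trans (fst≤⟪⟫ x (encodeList l)) (n≤1+n _)) ,
          cong (λ z → suc ⟪ x , z ⟫) (sym (tailCode-cons α x (encodeList l))) , refl)))))
      go (jC f gs l ys v p1 p2) = mkE ⌜ Cc f gs ⌝c (encodeList l) v refl
        (inj₂ (inj₂ (inj₂ (inj₂ (inj₁ (⌜ f ⌝c , s≤s (≤-trans (fst≤⟪⟫ ⌜ f ⌝c ⌜ gs ⌝cs) (snd≤⟪⟫ 4 _)) ,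
          ⌜ gs ⌝cs , s≤s (≤-trans (snd≤⟪⟫ ⌜ f ⌝c ⌜ gs ⌝cs) (snd≤⟪⟫ 4 _)) , refl ,
          encodeList ys , s≤s (≤-trans (c≤nodeCode 1 ⌜ gs ⌝cs (encodeList l) (encodeList ys)) (<⇒≤ (premB p1))) , prem p1 , prem p2))))))
      go (jR0 f g l v p1 p2) = mkE ⌜ Rc f g ⌝c (encodeList (0 ∷ l)) v refl
        (inj₂ (inj₂ (inj₂ (inj₂ (inj₂ (inj₁ (⌜ f ⌝c , s≤s (≤-trans (fst≤⟪⟫ ⌜ f ⌝c ⌜ g ⌝c) (snd≤⟪⟫ 5 _)) ,
          ⌜ g ⌝c , s≤s (≤-trans (snd≤⟪⟫ ⌜ f ⌝c ⌜ g ⌝c) (snd≤⟪⟫ 5 _)) , refl ,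
          inj₁ (cong (λ z → suc ⟪ 0 , z ⟫) (sym (tailCode-cons α 0 (encodeList l))) ,
                (let (j1 , l1 , i1) = prem p1 in
                  j1 , l1 , subst (λ z → NodeIs α L j1 (nodeCode 0 ⌜ f ⌝c z v)) (sym (tailCode-cons α 0 (encodeList l))) i1) ,
                prem p2))))))))
      go (jRS f g n l w v p1 p2) = mkE ⌜ Rc f g ⌝c (encodeList (suc n ∷ l)) v refl
        (inj₂ (inj₂ (inj₂ (inj₂ (inj₂ (inj₁ (⌜ f ⌝c , s≤s (≤-trans (fst≤⟪⟫ ⌜ f ⌝c ⌜ g ⌝c) (snd≤⟪⟫ 5 _)) ,
          ⌜ g ⌝c , s≤s (≤-trans (snd≤⟪⟫ ⌜ f ⌝c ⌜ g ⌝c) (snd≤⟪⟫ 5 _)) , refl ,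
          inj₂ (n , s≤s (≤-trans (n≤1+n n) (≤-trans (fst≤⟪⟫ (suc n) (encodeList l)) (n≤1+n _))) ,
                cong (λ z → suc ⟪ suc n , z ⟫) (sym (tailCode-cons α (suc n) (encodeList l))) ,
                w , s≤s (≤-trans (c≤nodeCode 0 ⌜ Rc f g ⌝c (encodeList (n ∷ l)) w) (<⇒≤ (premB p1))) ,
                (let (j1 , l1 , i1) = prem p1 in
                  j1 , l1 , subst (λ z → NodeIs α L j1 (nodeCode 0 ⌜ Rc f g ⌝c (suc ⟪ n , z ⟫) w)) (sym (tailCode-cons α (suc n) (encodeList l))) i1) ,
                (let (j2 , l2 , i2) = prem p2 in
                  j2 , l2 , subst (λ z → NodeIs α L j2 (nodeCode 0 ⌜ g ⌝c (suc ⟪ n , suc ⟪ w , z ⟫ ⟫) v)) (sym (tailCode-cons α (suc n) (encodeList l))) i2)))))))))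
      go (jM f l y p1 p2) = mkE ⌜ Mc f ⌝c (encodeList l) y refl
        (inj₂ (inj₂ (inj₂ (inj₂ (inj₂ (inj₂ (⌜ f ⌝c , s≤s (snd≤⟪⟫ 6 ⌜ f ⌝c) , refl , prem p1 ,
          λ z lz → let (w , mw) = p2 z lz in w , s≤s (≤-trans (n≤1+n w) (≤-trans (c≤nodeCode 0 ⌜ f ⌝c (encodeList (z ∷ l)) (suc w)) (<⇒≤ (premB mw)))) , prem mw)))))))
      go (jLn l) = mkL 0 (encodeList l) 0 refl (inj₁ (refl , refl))
      go (jLc g gs l y ys p1 p2) = mkL ⌜ g ∷ gs ⌝cs (encodeList l) (encodeList (y ∷ ys)) refl
        (inj₂ (⌜ g ⌝c , s≤s (≤-trans (fst≤⟪⟫ ⌜ g ⌝c ⌜ gs ⌝cs) (n≤1+n _)) , ⌜ gs ⌝cs , s≤s (≤-trans (snd≤⟪⟫ ⌜ g ⌝c ⌜ gs ⌝cs) (n≤1+n _)) , refl ,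
          y , s≤s (≤-trans (fst≤⟪⟫ y (encodeList ys)) (n≤1+n _)) ,
          cong (λ z → suc ⟪ y , z ⟫) (sym (tailCode-cons α y (encodeList ys))) , prem p1 ,
          (let (j2 , l2 , i2) = prem p2 in
            j2 , l2 , subst (λ z → NodeIs α L j2 (nodeCode 1 ⌜ gs ⌝cs (encodeList l) z)) (sym (tailCode-cons α y (encodeList ys))) i2)))
      go jKZ = mkC ⌜ Zc ⌝c refl (inj₁ refl)
      go jKS = mkC ⌜ Sc ⌝c refl (inj₂ (inj₁ refl))
      go jKO = mkC ⌜ Oc ⌝c refl (inj₂ (inj₂ (inj₁ refl)))
      go (jKP i) = mkC ⌜ Pc i ⌝c refl (inj₂ (inj₂ (inj₂ (inj₁ (i , s≤s (snd≤⟪⟫ 2 i) , refl)))))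
      go (jKC f gs p1 p2) = mkC ⌜ Cc f gs ⌝c refl
        (inj₂ (inj₂ (inj₂ (inj₂ (inj₁ (⌜ f ⌝c , s≤s (≤-trans (fst≤⟪⟫ ⌜ f ⌝c ⌜ gs ⌝cs) (snd≤⟪⟫ 4 _)) , ⌜ gs ⌝cs , s≤s (≤-trans (snd≤⟪⟫ ⌜ f ⌝c ⌜ gs ⌝cs) (snd≤⟪⟫ 4 _)) ,
          refl , prem p1 , prem p2))))))
      go (jKR f g p1 p2) = mkC ⌜ Rc f g ⌝c refl
        (inj₂ (inj₂ (inj₂ (inj₂ (inj₂ (inj₁ (⌜ f ⌝c , s≤s (≤-trans (fst≤⟪⟫ ⌜ f ⌝c ⌜ g ⌝c) (snd≤⟪⟫ 5 _)) , ⌜ g ⌝c , s≤s (≤-trans (snd≤⟪⟫ ⌜ f ⌝c ⌜ g ⌝c) (snd≤⟪⟫ 5 _)) ,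
          refl , prem p1 , prem p2)))))))
      go (jKM f p1) = mkC ⌜ Mc f ⌝c refl
        (inj₂ (inj₂ (inj₂ (inj₂ (inj₂ (inj₂ (⌜ f ⌝c , s≤s (snd≤⟪⟫ 6 ⌜ f ⌝c) , refl , prem p1)))))))
      go jKn = mkCL 0 refl (inj₁ refl)
      go (jKc g gs p1 p2) = mkCL ⌜ g ∷ gs ⌝cs refl
        (inj₂ (⌜ g ⌝c , s≤s (≤-trans (fst≤⟪⟫ ⌜ g ⌝c ⌜ gs ⌝cs) (n≤1+n _)) , ⌜ gs ⌝cs , s≤s (≤-trans (snd≤⟪⟫ ⌜ g ⌝c ⌜ gs ⌝cs) (n≤1+n _)) , refl , prem p1 , prem p2))


module HaltingCertificates where

  open Numbering
  open BoundedFormulas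
  open ListCoding
  open ComputationLogs
  open LogSoundness using (valid⇒sound; SoundNode)
  open Derivations
  open LogCompleteness
  open import Data.Nat
  open import Data.Nat.Properties
  open import Data.Vec using ([]; _∷_)
  open import Data.Fin using (zero; suc)
  open import Data.List using (List; []; _∷_; drop; length)
  open import Data.List.Membership.Propositional using (_∈_)
  open import Data.List.Relation.Unary.Any using (here; there)
  open import Data.Product using (Σ; _×_; _,_)
  open import Relation.Binary.PropositionalEquality hiding ([_])

  length≤encodeList : ∀ (Ls : List ℕ) → length Ls ≤ encodeList Ls
  length≤encodeList [] = z≤n
  length≤encodeList (x ∷ Ls) = s≤s (≤-trans (length≤encodeList Ls) (snd≤⟪⟫ x (encodeList Ls)))

  drop-<length : ∀ k (Ls : List ℕ) → k < length Ls → Σ ℕ λ u → Σ (List ℕ) λ r → drop k Ls ≡ u ∷ r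
  drop-<length zero (x ∷ Ls) _ = x , Ls , refl
  drop-<length (suc k) (x ∷ Ls) (s≤s l) = drop-<length k Ls l

  ∈⇒drop : ∀ {u} (Ls : List ℕ) → u ∈ Ls → Σ ℕ λ k → Σ (List ℕ) λ r → k < length Ls × drop k Ls ≡ u ∷ r
  ∈⇒drop (x ∷ Ls) (here refl) = 0 , Ls , s≤s z≤n , refl
  ∈⇒drop (x ∷ Ls) (there m) = let (k , r , l , e) = ∈⇒drop Ls m in suc k , r , s≤s l , e

  -- Abstract only for type-checking speed: the formula is very large.
  abstract
    halting : Fm 3
    halting = Certificate₀

    halting-sound : ∀ α t n e → Sat halting α (t ∷ n ∷ e ∷ []) → Σ ℕ λ v → Φ e (π₂ (π₂ α)) n v
    halting-sound α t n e (N , _ , allv , k , lk , v , _ , inK) =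
      let g = valid⇒sound α (suc zero) (N ∷ t ∷ n ∷ e ∷ []) N allv k lk
          (c , ec , ev) = SoundNode.eval-sound g e (suc ⟪ n , 0 ⟫) v inK (n ∷ []) refl
      in v , c , ec , ev

    halting-complete : ∀ α n e c v → ⌜ c ⌝c ≡ e → Eval (π₂ (π₂ α)) c (n ∷ []) v → Σ ℕ λ t → Sat halting α (t ∷ n ∷ e ∷ [])
    halting-complete α n e c v ec ev =
      let (Ls , cL , mem) = eval-derived α ev
          (k , r , lk , ek) = ∈⇒drop Ls mem
      in encodeList Ls , length Ls , s≤s (length≤encodeList Ls) ,
         (λ k' lk' → let (u , r' , e') = drop-<length k' Ls lk' in
                     Validity.derived⇒valid α Ls k' (length Ls) (n ∷ e ∷ []) u r' e' (cL k' u r' e')) ,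
         k , lk , v , s≤s (≤-trans (c≤nodeCode 0 ⌜ c ⌝c (suc ⟪ n , 0 ⟫) v) (<⇒≤ (drop⇒<encodeList k Ls _ r ek))) ,
         subst (λ z → NodeIs α (encodeList Ls) k (nodeCode 0 z (suc ⟪ n , 0 ⟫) v)) ec (drop⇒NodeIs α Ls k _ r ek)


module Approximation where

  open Numbering
  open BoundedFormulas
  open ListCoding
  open ComputationLogs
  open HaltingCertificates
  open import Data.Nat
  open import Data.Nat.Properties
  open import Data.Bool using (Bool; true; false; _∨_; not)
  open import Data.Bool.Properties using (∨-zeroʳ; ∨-identityʳ)
  open import Data.Vec using ([]; _∷_)
  open import Data.Fin using (Fin; zero; suc)
  open import Data.Product using (Σ; _×_; _,_; proj₁; proj₂)
  open import Data.Sum using (inj₁; inj₂)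
  open import Data.Empty using (⊥-elim)
  open import Relation.Nullary using (yes; no)
  open import Relation.Binary.PropositionalEquality

  private
    V : ∀ {m} → Fin m → Tm m
    V = var
    ↑ : ∀ {m} → Fin m → Fin (suc m)
    ↑ = suc

  ClosedTm : Set
  ClosedTm = ∀ {m} → Tm m

  HaltsBy : ∀ {m} → (n s : Fin m) → ClosedTm → Fm m
  HaltsBy n s E = ex (sc (V s)) (appF halting (V zero ∷ V (↑ n) ∷ E ∷ []))

  AllHaltBy : ∀ {m} → (m' s : Fin m) → ClosedTm → Fm m
  AllHaltBy m' s E = all (sc (V m')) (let s = ↑ s ; n = zero in HaltsBy n s E)

  agreementTm : ∀ {m} → Fin m → ClosedTm → Tm m
  agreementTm s E = mu (sc (V s)) (let s = ↑ s ; m' = zero in or (eq (V m') (V s)) (neg (AllHaltBy m' s E)))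

  AgreementStable : ∀ {m} → Fin m → ClosedTm → Fm m
  AgreementStable h E = ex (sc (sc (V h))) (let h = ↑ h ; h' = zero in and (eq (V h') (sc (V h))) (eq (agreementTm h' E) (agreementTm h E)))

  index₀ index₁ : ClosedTm
  index₀ = ora (lit 0)
  index₁ = ora (lit 1)

  -- StableAt (2h) says that the length of agreement of the index α 0 is the same at stages h
  -- and h + 1; StableAt (2h + 1) says the same for the index α 1.
  StableAt : Fm 1
  StableAt = let m = zero in
    or (ex (sc (V m)) (let m = ↑ m ; h = zero in and (eq (V m) (add (V h) (V h))) (AgreementStable h index₀)))
       (ex (sc (V m)) (let m = ↑ m ; h = zero in and (eq (V m) (sc (add (V h) (V h)))) (AgreementStable h index₁)))

  llpoInputTm : Tm 1
  llpoInputTm = ind StableAt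

  ChangesInfinitelyOften : (ℕ → ℕ) → Set
  ChangesInfinitelyOften f = ∀ N → Σ ℕ λ m → N ≤ m × f (suc m) ≢ f m

  change-between : ∀ (f : ℕ → ℕ) N S → N ≤ S → f N ≢ f S → Σ ℕ λ m → N ≤ m × f (suc m) ≢ f m
  change-between f N zero z≤n ne = ⊥-elim (ne refl)
  change-between f N (suc S) le ne with m≤n⇒m<n∨m≡n le
  ... | inj₂ refl = ⊥-elim (ne refl)
  ... | inj₁ (s≤s le') with f (suc S) ≟ f S
  ...   | no ne' = S , le' , ne'
  ...   | yes eqq = change-between f N S le' (λ e' → ne (trans e' (sym eqq)))

  -- agreement s is the length of agreement of the index α i at stage s.
  module Agreement (α : Baire) (i : ℕ) where
    e = α i
    p = π₂ (π₂ α)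

    certifies : ℕ → ℕ → Bool
    certifies n t = ev halting α (t ∷ n ∷ e ∷ [])

    haltsᵇ : ℕ → ℕ → Bool
    haltsᵇ n s = anyB (λ t → certifies n t) (suc s)

    allHaltᵇ : ℕ → ℕ → Bool
    allHaltᵇ m s = allB (λ n → haltsᵇ n s) (suc m)

    settles : ℕ → ℕ → Bool
    settles s m = (m ≡ᵇ s) ∨ not (allHaltᵇ m s)

    agreement : ℕ → ℕ
    agreement s = muN (settles s) (suc s)

    haltsᵇ-sound : ∀ n s → haltsᵇ n s ≡ true → Σ ℕ λ v → Φ e p n v
    haltsᵇ-sound n s h = let (t , _ , c) = anyB→ (λ t → certifies n t) (suc s) h in halting-sound α t n e (ev-sound halting α _ c)

    haltsᵇ-complete : ∀ n v → Φ e p n v → Σ ℕ λ s → haltsᵇ n s ≡ true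
    haltsᵇ-complete n v (c , ec , evl) = let (t , st) = halting-complete α n e c v ec evl in
      t , →anyB (λ t' → certifies n t') (suc t) t ≤-refl (ev-complete halting α _ st)

    haltsᵇ-mono : ∀ n s s' → haltsᵇ n s ≡ true → s ≤ s' → haltsᵇ n s' ≡ true
    haltsᵇ-mono n s s' h le = let (t , lt , c) = anyB→ (λ t → certifies n t) (suc s) h in →anyB (λ t → certifies n t) (suc s') t (≤-trans lt (s≤s le)) c

    allHaltᵇ⇒ : ∀ m s → allHaltᵇ m s ≡ true → ∀ n → n ≤ m → haltsᵇ n s ≡ true
    allHaltᵇ⇒ m s h n le = allB→ (λ n → haltsᵇ n s) (suc m) h n (s≤s le)

    ⇒allHaltᵇ : ∀ m s → (∀ n → n ≤ m → haltsᵇ n s ≡ true) → allHaltᵇ m s ≡ true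
    ⇒allHaltᵇ m s h = →allB (λ n → haltsᵇ n s) (suc m) λ n l → h n (s≤s⁻¹ l)

    settles-self : ∀ s → settles s s ≡ true
    settles-self s rewrite ≡⇒≡ᵇ-true s s refl = refl

    agreement-least : ∀ s y → settles s y ≡ true → y < suc s → agreement s ≤ y
    agreement-least s y q l = proj₂ (mu-spec (settles s) (suc s) y q l)

    agreement-stops : ∀ s → settles s (agreement s) ≡ true
    agreement-stops s = proj₁ (mu-spec (settles s) (suc s) s (settles-self s) ≤-refl)

    allHaltᵇ-mono : ∀ m s s' → allHaltᵇ m s ≡ true → s ≤ s' → allHaltᵇ m s' ≡ true
    allHaltᵇ-mono m s s' h le = ⇒allHaltᵇ m s' λ n l → haltsᵇ-mono n s s' (allHaltᵇ⇒ m s h n l) le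

    allHaltᵇ-anti : ∀ m m' s → allHaltᵇ m s ≡ true → m' ≤ m → allHaltᵇ m' s ≡ true
    allHaltᵇ-anti m m' s h le = ⇒allHaltᵇ m' s λ n l → allHaltᵇ⇒ m s h n (≤-trans l le)

    agreement≤ : ∀ s → agreement s ≤ s
    agreement≤ s = agreement-least s s (settles-self s) ≤-refl

    settles-unless-allHalt : ∀ s m → allHaltᵇ m s ≡ false → settles s m ≡ true
    settles-unless-allHalt s m h = trans (cong (λ b → (m ≡ᵇ s) ∨ not b) h) (∨-zeroʳ (m ≡ᵇ s))

    settles∧allHalt⇒≡ : ∀ s m → settles s m ≡ true → allHaltᵇ m s ≡ true → m ≡ s
    settles∧allHalt⇒≡ s m h a =
      ≡ᵇ-true⇒≡ m s (trans (sym (∨-identityʳ (m ≡ᵇ s))) (subst (λ b → ((m ≡ᵇ s) ∨ not b) ≡ true) a h))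

    <agreement⇒allHalt : ∀ n s → n < agreement s → allHaltᵇ n s ≡ true
    <agreement⇒allHalt n s lt with allHaltᵇ n s in halted
    ... | true = refl
    ... | false = ⊥-elim (<⇒≱ lt (agreement-least s n (settles-unless-allHalt s n halted)
                                     (s≤s (≤-trans (<⇒≤ lt) (agreement≤ s)))))

    allHalt⇒<agreement : ∀ N s → allHaltᵇ N s ≡ true → N < s → N < agreement s
    allHalt⇒<agreement N s h lt with ≤-<-connex (agreement s) N
    ... | inj₂ N<agreement = N<agreement
    ... | inj₁ agreement≤N = ⊥-elim (<-irrefl
          (settles∧allHalt⇒≡ s _ (agreement-stops s) (allHaltᵇ-anti N _ s h agreement≤N))
          (≤-<-trans agreement≤N lt))

    settles-pred : ∀ s q → q < suc s → settles (suc s) q ≡ true → settles s q ≡ true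
    settles-pred s q lt h with allHaltᵇ q s in halted
    ... | false = ∨-zeroʳ (q ≡ᵇ s)
    ... | true = ⊥-elim (<-irrefl (settles∧allHalt⇒≡ (suc s) q h (allHaltᵇ-mono q s (suc s) halted (n≤1+n s))) lt)

    agreement≤suc : ∀ s → agreement s ≤ agreement (suc s)
    agreement≤suc s with m≤n⇒m<n∨m≡n (agreement≤ (suc s))
    ... | inj₁ lt = agreement-least s _ (settles-pred s _ lt (agreement-stops (suc s))) lt
    ... | inj₂ same = ≤-trans (agreement≤ s) (≤-trans (n≤1+n s) (≤-reflexive (sym same)))

    agreement-mono : ∀ s s' → s ≤ s' → agreement s ≤ agreement s'
    agreement-mono s s' le with m≤n⇒m<n∨m≡n le
    ... | inj₂ refl = ≤-refl
    ... | inj₁ (s≤s {n = s''} l) = ≤-trans (agreement-mono s s'' l) (agreement≤suc s'')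

    ∞-changes⇒Tot : ChangesInfinitelyOften agreement → Tot e p
    ∞-changes⇒Tot inf n = let (s , le) = grow (suc n) in haltsᵇ-sound n s (allHaltᵇ⇒ n s (<agreement⇒allHalt n s le) n ≤-refl)
      where
      grow : ∀ c → Σ ℕ λ s → c ≤ agreement s
      grow zero = 0 , z≤n
      grow (suc c) =
        let (s , le) = grow c
            (m , sm , ne) = inf s
            l1 = ≤-trans le (agreement-mono s m sm)
            l2 : agreement m < agreement (suc m)
            l2 = ≤∧≢⇒< (agreement≤suc m) (λ eqq → ne (sym eqq))
        in suc m , ≤-trans (s≤s l1) l2

    Tot⇒∞-changes : Tot e p → ChangesInfinitelyOften agreement
    Tot⇒∞-changes tot N =
      let (S , lt , pb) = allHalt-stage N
      in change-between agreement N S (<⇒≤ lt) (λ eqq → <-irrefl refl (≤-<-trans (≤-trans (≤-reflexive (sym eqq)) (agreement≤ N)) (allHalt⇒<agreement N S pb lt)))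
      where
      allHalt-stage : ∀ N → Σ ℕ λ S → N < S × allHaltᵇ N S ≡ true
      allHalt-stage zero = let (v , φ) = tot 0
                               (s , h) = haltsᵇ-complete 0 v φ
                  in suc s , s≤s z≤n , ⇒allHaltᵇ 0 (suc s) λ { zero _ → haltsᵇ-mono 0 s (suc s) h (n≤1+n s) }
      allHalt-stage (suc N) =
        let (S , lt , pb) = allHalt-stage N
            (v , φ) = tot (suc N)
            (s , h) = haltsᵇ-complete (suc N) v φ
            S' = suc (S + s)
        in S' , s≤s (≤-trans lt (m≤m+n S s)) , ⇒allHaltᵇ (suc N) S' λ n l → pick n l S lt pb s h
        where
        pick : ∀ n → n ≤ suc N → ∀ S → N < S → allHaltᵇ N S ≡ true → ∀ s → haltsᵇ (suc N) s ≡ true → haltsᵇ n (suc (S + s)) ≡ true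
        pick n l S lt pb s h with m≤n⇒m<n∨m≡n l
        ... | inj₁ (s≤s l') = haltsᵇ-mono n S _ (allHaltᵇ⇒ N S pb n l') (≤-trans (m≤m+n S s) (n≤1+n _))
        ... | inj₂ refl = haltsᵇ-mono (suc N) s _ h (≤-trans (m≤n+m s S) (n≤1+n _))


module Reduction where

  open Numbering
  open PrimitiveRecursion using (b2n)
  open BoundedFormulas
  open FormulaCompilation
  open Approximation
  open import Data.Nat
  open import Data.Nat.Properties
  open import Data.Bool using (true; false)
  open import Data.Vec using ([]; _∷_)
  open import Data.Fin using (zero; suc)
  open import Data.Product using (_,_; proj₁; proj₂)
  open import Data.Sum using (inj₁; inj₂)
  open import Data.Empty using (⊥-elim)
  open import Relation.Nullary using (¬_; yes; no)
  open import Relation.Binary.PropositionalEquality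

  double-injective : ∀ a b → a + a ≡ b + b → a ≡ b
  double-injective zero zero e = refl
  double-injective zero (suc b) ()
  double-injective (suc a) zero ()
  double-injective (suc a) (suc b) e rewrite +-suc a a | +-suc b b = cong suc (double-injective a b (suc-injective (suc-injective e)))

  π₂-⟨⟩ : ∀ (a b : Baire) → π₂ ⟨ a , b ⟩ ≈B b
  π₂-⟨⟩ a b zero = refl
  π₂-⟨⟩ a b (suc n) rewrite +-suc n n = π₂-⟨⟩ (λ k → a (suc k)) (λ k → b (suc k)) n

  b2n≡0⇒false : ∀ b → b2n b ≡ 0 → b ≡ false
  b2n≡0⇒false false _ = refl
  b2n≡0⇒false true ()

  llpoInput : Baire → Baire
  llpoInput x n = ⟦ llpoInputTm ⟧ x (n ∷ [])

  module Correctness (x : Baire) where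
    module Index₀ = Agreement x 0
    module Index₁ = Agreement x 1

    sat-even : ∀ h → Sat StableAt x (h + h ∷ []) → Index₀.agreement (suc h) ≡ Index₀.agreement h
    sat-even h (inj₁ (h₁ , _ , e1 , h' , _ , e2 , e3)) with double-injective h h₁ e1
    ... | refl rewrite e2 = e3
    sat-even h (inj₂ (h₁ , _ , e1 , _)) = ⊥-elim (double≢suc-double h h₁ e1)

    even-sat : ∀ h → Index₀.agreement (suc h) ≡ Index₀.agreement h → Sat StableAt x (h + h ∷ [])
    even-sat h e = inj₁ (h , s≤s (m≤m+n h h) , refl , suc h , ≤-refl , refl , e)

    sat-odd : ∀ h → Sat StableAt x (suc (h + h) ∷ []) → Index₁.agreement (suc h) ≡ Index₁.agreement h
    sat-odd h (inj₂ (h₁ , _ , e1 , h' , _ , e2 , e3)) with double-injective h h₁ (suc-injective e1)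
    ... | refl rewrite e2 = e3
    sat-odd h (inj₁ (h₁ , _ , e1 , _)) = ⊥-elim (double≢suc-double h₁ h (sym e1))

    odd-sat : ∀ h → Index₁.agreement (suc h) ≡ Index₁.agreement h → Sat StableAt x (suc (h + h) ∷ [])
    odd-sat h e = inj₂ (h , s≤s (≤-trans (m≤m+n h h) (n≤1+n _)) , refl , suc h , ≤-refl , refl , e)

    llpoInput≡0⇒¬Stable : ∀ m → llpoInput x m ≡ 0 → ¬ Sat StableAt x (m ∷ [])
    llpoInput≡0⇒¬Stable m e s with trans (sym (ev-complete StableAt x (m ∷ []) s)) (b2n≡0⇒false _ e)
    ... | ()

    ¬Stable⇒llpoInput≡0 : ∀ m → ¬ Sat StableAt x (m ∷ []) → llpoInput x m ≡ 0
    ¬Stable⇒llpoInput≡0 m ns with ev StableAt x (m ∷ []) in eqq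
    ... | true = ⊥-elim (ns (ev-sound StableAt x (m ∷ []) eqq))
    ... | false = refl

    p = π₂ (π₂ x)

    π₁-InfZero⇒Tot : InfZero (π₁ (llpoInput x)) → Tot (x 0) p
    π₁-InfZero⇒Tot inf = Index₀.∞-changes⇒Tot λ N → let (m , le , e) = inf N in m , le , λ q → llpoInput≡0⇒¬Stable (m + m) e (even-sat m q)

    Tot⇒π₁-InfZero : Tot (x 0) p → InfZero (π₁ (llpoInput x))
    Tot⇒π₁-InfZero tot N = let (m , le , ne) = Index₀.Tot⇒∞-changes tot N in m , le , ¬Stable⇒llpoInput≡0 (m + m) λ s → ne (sat-even m s)

    π₂-InfZero⇒Tot : InfZero (π₂ (llpoInput x)) → Tot (x 1) p
    π₂-InfZero⇒Tot inf = Index₁.∞-changes⇒Tot λ N → let (m , le , e) = inf N in m , le , λ q → llpoInput≡0⇒¬Stable (suc (m + m)) e (odd-sat m q)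

    Tot⇒π₂-InfZero : Tot (x 1) p → InfZero (π₂ (llpoInput x))
    Tot⇒π₂-InfZero tot N = let (m , le , ne) = Index₁.Tot⇒∞-changes tot N in m , le , ¬Stable⇒llpoInput≡0 (suc (m + m)) λ s → ne (sat-odd m s)

  llpoInputCode : Code
  llpoInputCode = proj₁ (Tm-computable llpoInputTm)

  llpoInput-computed : ∀ x → ⌜ llpoInputCode ⌝c ⊢ x ↦ llpoInput x
  llpoInput-computed x n = llpoInputCode , refl , proj₂ (Tm-computable llpoInputTm) x (n ∷ [])

  π₂Tm : Tm 1
  π₂Tm = ora (sc (add (var zero) (var zero)))

  π₂Code : Code
  π₂Code = proj₁ (Tm-computable π₂Tm)

  π₂-computed : ∀ z → ⌜ π₂Code ⌝c ⊢ z ↦ π₂ z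
  π₂-computed z n = π₂Code , refl , proj₂ (Tm-computable π₂Tm) z (n ∷ [])

  llpoInput-unique : ExcludedMiddle 0ℓ → ∀ x → dom Δ⁰₂-LEM x → dom (Unique Σ⁰₂-LLPO) (llpoInput x)
  llpoInput-unique lem x (_ , _ , complementary) with lem {Tot (x 1) (π₂ (π₂ x))}
  ... | yes tot₁ = inj₂ (Tot⇒π₂-InfZero tot₁) , (λ _ → 1) , inj₂ (Tot⇒π₂-InfZero tot₁ , λ _ → refl) , only-one
    where
    open Correctness x
    only-one : ∀ z → sol Σ⁰₂-LLPO (llpoInput x) z → z ≈B (λ _ → 1)
    only-one z (inj₁ (inf₀ , _)) = ⊥-elim (proj₁ (complementary p) (π₁-InfZero⇒Tot inf₀) tot₁)
    only-one z (inj₂ (_ , z≡1)) = z≡1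
  ... | no ¬tot₁ = inj₁ (Tot⇒π₁-InfZero tot₀) , (λ _ → 0) , inj₁ (Tot⇒π₁-InfZero tot₀ , λ _ → refl) , only-one
    where
    open Correctness x
    tot₀ = proj₂ (complementary p) ¬tot₁
    only-one : ∀ z → sol Σ⁰₂-LLPO (llpoInput x) z → z ≈B (λ _ → 0)
    only-one z (inj₁ (_ , z≡0)) = z≡0
    only-one z (inj₂ (inf₁ , _)) = ⊥-elim (¬tot₁ (π₂-InfZero⇒Tot inf₁))

  llpoAnswer-solves : ∀ x → dom Δ⁰₂-LEM x → ∀ z → sol Σ⁰₂-LLPO (llpoInput x) z → sol Δ⁰₂-LEM x (π₂ ⟨ x , z ⟩)
  llpoAnswer-solves x _ z (inj₁ (inf₀ , z≡0)) =
    inj₁ (π₁-InfZero⇒Tot inf₀ , λ n → trans (π₂-⟨⟩ x z n) (z≡0 n))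
    where open Correctness x
  llpoAnswer-solves x (_ , _ , complementary) z (inj₂ (inf₁ , z≡1)) =
    inj₂ ((λ tot₀ → proj₁ (complementary p) tot₀ (π₂-InfZero⇒Tot inf₁)) , λ n → trans (π₂-⟨⟩ x z n) (z≡1 n))
    where open Correctness x


open Reduction

proposition6p6 : ExcludedMiddle 0ℓ → Δ⁰₂-LEM ≤W Unique Σ⁰₂-LLPO
proposition6p6 lem = ⌜ llpoInputCode ⌝c , ⌜ π₂Code ⌝c , λ x d q realizes →
  let unique = llpoInput-unique lem x d
      answer = q (llpoInput x)
  in llpoInput x , llpoInput-computed x , unique ,
     π₂ ⟨ x , answer ⟩ , π₂-computed ⟨ x , answer ⟩ , llpoAnswer-solves x d answer (realizes _ unique)
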